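{- Let $\pi = \oplus[\xi_1, \ldots, \xi_r]$ (with $r \geq 2$) where every $\xi_i$ is an increasing oscillation. Then the set $P(\pi)$ of pin words encoding $\pi$ is $$P(\pi) = \bigcup_{1\leq i \leq r-1} P(\oplus[\xi_i,\xi_{i+1}]) \cdot \operatorname{Sh}\Big( \big(P^{(1)}(\xi_{i-1}) , \ldots , P^{(1)}(\xi_1) \big) ,\ \big(P^{(3)}(\xi_{i+2}) , \ldots , P^{(3)}(\xi_r) \big) \Big),$$ where $\operatorname{Sh}$ denotes the shuffle product of sequences of sets of words defined below.
   Context: Pin words are words over the alphabet $\{1,2,3,4,U,D,L,R\}$ encoding pin representations of permutations (sequences of points in which each new point lies outside the bounding box of the previous ones and either separates the last point from the earlier ones, encoded by a direction $U,D,L,R$, or is independent of them, encoded by the numeral $1,2,3,4$ of the quadrant it lies in, relative to an origin point $p_0$). For a permutation $\sigma$, $P(\sigma)$ is the set of pin words encoding $\sigma$. $\oplus[\pi_1,\ldots,\pi_k]$ denotes the substitution (inflation) of $\pi_1,\ldots,\pi_k$ into the identity permutation $12\ldots k$. An increasing oscillation is a permutation among $1, 21, 231, 312$, or, for size $n\geq 4$, a simple permutation of size $n$ contained as a pattern in the infinite sequence $3\,1\,5\,2\,7\,4\,9\,6\ldots(2k+1)\,(2k-2)\ldots$. For an increasing oscillation $\xi$ and $h \in \{1,3\}$, $P^{(h)}(\xi)$ denotes the set of pin words encoding $\xi$ whose origin lies in quadrant $h$ with respect to the bounding box of the points of $\xi$. Concatenation of sets of words is $X\cdot Y = \{xy :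 x\in X, y\in Y\}$. For sequences of sets of words ${\mathsf A} = ({\mathsf A}_1,\ldots,{\mathsf A}_q)$ and ${\mathsf B} = ({\mathsf B}_1,\ldots,{\mathsf B}_s)$, the shuffle product $\operatorname{Sh}({\mathsf A},{\mathsf B})$ is the set of words $c = c_1 c_2\cdots c_{q+s}$ such that there exist disjoint index sets $I=\{i_1<\ldots<i_q\}$ and $J=\{j_1<\ldots<j_s\}$ with $I\cup J=\{1,\ldots,q+s\}$, $c_{i_k}\in{\mathsf A}_k$ for all $k\leq q$ and $c_{j_k}\in{\mathsf B}_k$ for all $k\leq s$. Empty sequences (e.g. when $i=1$ or $i+2>r$) contribute nothing. -}

module Defs where

open import Data.Nat using (ℕ; zero; suc; _+_; _∸_; _<_; _≤_)
open import Data.Product using (Σ; ∃; _×_; _,_; proj₁; proj₂)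
open import Data.Sum using (_⊎_)
open import Data.Empty using (⊥)
open import Data.Unit using (⊤)
open import Data.List using (List; []; _∷_; _++_; map; length; lookup; upTo)
open import Data.List.Membership.Propositional using (_∈_)
open import Data.List.Relation.Unary.All using (All)
open import Data.List.Relation.Binary.Permutation.Propositional using (_↭_)
open import Data.Fin as Fin using (Fin)
open import Function.Bundles using (_⇔_)
open import Relation.Binary.PropositionalEquality using (_≡_)

-- Permutations in one-line notation, values 0 .. n-1.

IsPerm : List ℕ → Set
IsPerm σ = σ ↭ upTo (length σ)

⊕ : List (List ℕ) → List ℕ
⊕ []       = []
⊕ (σ ∷ σs) = σ ++ map (length σ +_) (⊕ σs)

data Letter : Set where
  n1 n2 n3 n4 : Letter     -- numerals 1,2,3,4 (quadrants NE, NW, SW, SE)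
  U D L R     : Letter

Word : Set
Word = List Letter

Lang : Set₁
Lang = Word → Set

Point : Set
Point = ℕ × ℕ

px py : Point → ℕ
px = proj₁
py = proj₂

InQuadrant : Letter → List Point → Point → Set
InQuadrant n1 S p = All (λ q → px q < px p × py q < py p) S
InQuadrant n2 S p = All (λ q → px p < px q × py q < py p) S
InQuadrant n3 S p = All (λ q → px p < px q × py p < py q) S
InQuadrant n4 S p = All (λ q → px q < px p × py p < py q) S
InQuadrant _  S p = ⊥

-- the value c separates the coordinate a of the last point from the
-- coordinates E of the earlier points
Separates : ℕ → List ℕ → ℕ → Set
Separates a E c = (a < c × All (c <_) E) ⊎ (c < a × All (_< c) E)

-- Pin m prev p : the new point p is a valid pin encoded by letter m,
-- where prev = p_{i-1} ∷ p_{i-2} ∷ … ∷ p_0 are the previous points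
-- (most recent first, origin p_0 last).
Pin : Letter → List Point → Point → Set
Pin U (a ∷ e ∷ E) p =
  All (λ q → py q < py p) (a ∷ e ∷ E) × Separates (px a) (map px (e ∷ E)) (px p)
Pin D (a ∷ e ∷ E) p =
  All (λ q → py p < py q) (a ∷ e ∷ E) × Separates (px a) (map px (e ∷ E)) (px p)
Pin R (a ∷ e ∷ E) p =
  All (λ q → px q < px p) (a ∷ e ∷ E) × Separates (py a) (map py (e ∷ E)) (py p)
Pin L (a ∷ e ∷ E) p =
  All (λ q → px p < px q) (a ∷ e ∷ E) × Separates (py a) (map py (e ∷ E)) (py p)
Pin U _ p = ⊥
Pin D _ p = ⊥
Pin R _ p = ⊥
Pin L _ p = ⊥
Pin m S p = InQuadrant m S p

RealizesFrom : List Point → Word → List Point → Set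
RealizesFrom prev []      []       = ⊤
RealizesFrom prev (m ∷ w) (p ∷ ps) = Pin m prev p × RealizesFrom (p ∷ prev) w ps
RealizesFrom prev _       _        = ⊥

Realizes : Point → Word → List Point → Set
Realizes p0 w ps = RealizesFrom (p0 ∷ []) w ps

-- the points ps (in any order) form the permutation σ: there is a map τ
-- sending each point to its column such that the horizontal order of the
-- points is the order of columns and the vertical order is the order of values
FormsPerm : List Point → List ℕ → Set
FormsPerm ps σ =
  Σ (Fin (length ps) → Fin (length σ)) λ τ →
    length ps ≡ length σ ×
    (∀ i j → (px (lookup ps i) < px (lookup ps j) ⇔ Fin._<_ (τ i) (τ j))
           × (py (lookup ps i) < py (lookup ps j) ⇔ lookup σ (τ i) < lookup σ (τ j)))

P : List ℕ → Lang
P σ w = Σ Point λ p0 → Σ (List Point) λ ps → Realizes p0 w ps × FormsPerm ps σ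

-- P^(h)(σ) : pin words encoding σ whose origin lies in quadrant h with
-- respect to the bounding box of the points of σ (h given as a numeral letter)
Pq : Letter → List ℕ → Lang
Pq h σ w = Σ Point λ p0 → Σ (List Point) λ ps →
  Realizes p0 w ps × FormsPerm ps σ × InQuadrant h ps p0

_·_ : Lang → Lang → Lang
(X · Y) w = Σ Word λ x → Σ Word λ y → w ≡ x ++ y × X x × Y y

Sh : List Lang → List Lang → Lang
Sh []       []       w = w ≡ []
Sh (A ∷ As) []       w = Σ Word λ a → Σ Word λ w′ → w ≡ a ++ w′ × A a × Sh As [] w′
Sh []       (B ∷ Bs) w = Σ Word λ b → Σ Word λ w′ → w ≡ b ++ w′ × B b × Sh [] Bs w′
Sh (A ∷ As) (B ∷ Bs) w =
  (Σ Word λ a → Σ Word λ w′ → w ≡ a ++ w′ × A a × Sh As (B ∷ Bs) w′)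
  ⊎ (Σ Word λ b → Σ Word λ w′ → w ≡ b ++ w′ × B b × Sh (A ∷ As) Bs w′)

-- the infinite sequence 3 1 5 2 7 4 9 6 … (2k+1)(2k-2) …, 0-indexed positions
oscSeq : ℕ → ℕ
oscSeq 0 = 3
oscSeq 1 = 1
oscSeq 2 = 5
oscSeq 3 = 2
oscSeq (suc (suc (suc (suc n)))) = 2 + oscSeq (suc (suc n))

ContainedInOscSeq : List ℕ → Set
ContainedInOscSeq σ =
  Σ (Fin (length σ) → ℕ) λ f →
    (∀ k l → Fin._<_ k l → f k < f l) ×
    (∀ k l → (oscSeq (f k) < oscSeq (f l) ⇔ lookup σ k < lookup σ l))

Contiguous : List ℕ → Set
Contiguous m = ∀ u v x → u ∈ m → v ∈ m → u ≤ x → x ≤ v → x ∈ m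

Simple : List ℕ → Set
Simple σ = ∀ pre mid suf → σ ≡ pre ++ mid ++ suf → Contiguous mid →
  length mid ≤ 1 ⊎ length mid ≡ length σ

IncreasingOscillation : List ℕ → Set
IncreasingOscillation σ =
  IsPerm σ ×
  (σ ≡ 0 ∷ []  ⊎  σ ≡ 1 ∷ 0 ∷ []  ⊎  σ ≡ 1 ∷ 2 ∷ 0 ∷ []  ⊎  σ ≡ 2 ∷ 0 ∷ 1 ∷ []
   ⊎ (4 ≤ length σ × Simple σ × ContainedInOscSeq σ))

-- Every pin lies outside the bounding box of the earlier points, so the last pin of a
-- pin sequence for π = ⊕[ξ₁,…,ξᵣ] with r ≥ 3 cannot belong to a middle block, whose
-- points lie above-right of ξ₁ and below-left of ξᵣ. Say it belongs to ξ₁, and let u be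
-- the point just before the final run of points of ξ₁. Some point v of ξ₂ ⊕ ⋯ ⊕ ξᵣ
-- precedes u and lies above-right of the run, and a pin below-left of a point of its
-- history other than the previous pin is below-left of that whole older history. So an
-- earlier point of ξ₁ would lie above-right of the entire run, and ξ₁ would split as a
-- sum, which an increasing oscillation never does. Hence the word is a pin word of
-- ⊕[ξ₂,…,ξᵣ] followed by one of ξ₁ whose origin u lies in quadrant 1, and peeling the
-- outer blocks off one at a time yields the shuffle. Conversely, once one of the two
-- point sets is translated far enough up-right, each such concatenation is again a pin
-- word of π.

{-# OPTIONS --safe #-}
module Submission where

open import Defs
open import Data.Nat using (ℕ; zero; suc; _+_; _∸_; _<_; _≤_; z≤n; s≤s; s≤s⁻¹; _<?_; _≤?_; _≟_)
open import Data.Nat.Properties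
open import Data.Product using (Σ; _×_; _,_; proj₁; proj₂; map₂)
open import Data.Sum using (_⊎_; inj₁; inj₂; [_,_]′)
open import Data.Empty using (⊥; ⊥-elim)
open import Data.Unit using (tt)
open import Data.List using (List; []; _∷_; _++_; _∷ʳ_; _ʳ++_; map; length; reverse; filter; lookup; tabulate; take; drop; initLast; _∷ʳ′_)
open import Data.List.Properties
open import Data.List.Extrema.Nat using (max; xs≤max)
open import Data.List.Relation.Unary.All as All using (All; []; _∷_)
import Data.List.Relation.Unary.All.Properties as All
open import Data.List.Relation.Unary.All.Properties.Core using (¬All⇒Any¬)
open import Data.List.Relation.Unary.Any using (here; there)
open import Data.List.Relation.Unary.Any.Properties using (reverseAcc⁺; reverseAcc⁻; reverse⁻)
open import Data.List.Relation.Unary.AllPairs using (AllPairs; []; _∷_)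
import Data.List.Relation.Unary.AllPairs.Properties as AllPairs
open import Data.List.Relation.Unary.Unique.Propositional using (Unique)
open import Data.List.Membership.Propositional using (_∈_; find)
open import Data.List.Membership.Propositional.Properties
open import Data.List.Membership.DecPropositional _≟_ using (_∈?_)
open import Data.List.Relation.Binary.Permutation.Propositional using (_↭_; ↭-sym)
open import Data.List.Relation.Binary.Permutation.Propositional.Properties using (++-comm; ∈-resp-↭; ↭-length)
open import Data.Fin as Fin using (Fin; toℕ; fromℕ<)
open import Data.Fin.Properties using (toℕ<n; toℕ-fromℕ<)
open import Function using (_∘_)
open import Function.Bundles using (_⇔_; mk⇔; Equivalence)
open import Relation.Binary.PropositionalEquality
open import Relation.Binary.Definitions using (tri<; tri≈; tri>)
open import Relation.Nullary using (¬_; yes; no)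
open import Relation.Unary using (Decidable)

-- Reading past the end of the list yields the junk value 0.
nth : List ℕ → ℕ → ℕ
nth []       _       = 0
nth (x ∷ xs) zero    = x
nth (x ∷ xs) (suc t) = nth xs t

nth-lookup : ∀ σ (i : Fin (length σ)) → nth σ (toℕ i) ≡ lookup σ i
nth-lookup (x ∷ σ) Fin.zero    = refl
nth-lookup (x ∷ σ) (Fin.suc i) = nth-lookup σ i

nth-++ˡ : ∀ σ ρ {t} → t < length σ → nth (σ ++ ρ) t ≡ nth σ t
nth-++ˡ (x ∷ σ) ρ {zero}  _       = refl
nth-++ˡ (x ∷ σ) ρ {suc t} (s≤s h) = nth-++ˡ σ ρ h

nth-++ʳ : ∀ σ ρ t → nth (σ ++ ρ) (length σ + t) ≡ nth ρ t
nth-++ʳ []      ρ t = refl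
nth-++ʳ (x ∷ σ) ρ t = nth-++ʳ σ ρ t

nth-map : ∀ f ρ {t} → t < length ρ → nth (map f ρ) t ≡ f (nth ρ t)
nth-map f (x ∷ ρ) {zero}  _       = refl
nth-map f (x ∷ ρ) {suc t} (s≤s h) = nth-map f ρ h

nth-∈ : ∀ σ {t} → t < length σ → nth σ t ∈ σ
nth-∈ (x ∷ σ) {zero}  _       = here refl
nth-∈ (x ∷ σ) {suc t} (s≤s h) = there (nth-∈ σ h)

∈⇒nth : ∀ σ {v} → v ∈ σ → Σ ℕ λ t → t < length σ × nth σ t ≡ v
∈⇒nth (x ∷ σ) (here refl) = zero , s≤s z≤n , refl
∈⇒nth (x ∷ σ) (there v∈) with t , t< , eq ← ∈⇒nth σ v∈ = suc t , s≤s t< , eq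

∈-take⇒nth : ∀ j σ {v} → v ∈ take j σ → Σ ℕ λ t → t < j × nth σ t ≡ v
∈-take⇒nth (suc j) (x ∷ σ) (here refl) = zero , s≤s z≤n , refl
∈-take⇒nth (suc j) (x ∷ σ) (there v∈) with t , t< , eq ← ∈-take⇒nth j σ v∈ = suc t , s≤s t< , eq

∈-drop⇒nth : ∀ j σ {v} → v ∈ drop j σ → Σ ℕ λ t → j ≤ t × t < length σ × nth σ t ≡ v
∈-drop⇒nth zero    σ       v∈ with t , t< , eq ← ∈⇒nth σ v∈ = t , z≤n , t< , eq
∈-drop⇒nth (suc j) (x ∷ σ) v∈ with t , j≤t , t< , eq ← ∈-drop⇒nth j σ v∈ = suc t , s≤s j≤t , s≤s t< , eq

∈⇒nonempty : ∀ {A : Set} {x : A} {xs} → x ∈ xs → 1 ≤ length xs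
∈⇒nonempty (here _)  = s≤s z≤n
∈⇒nonempty (there _) = s≤s z≤n

nonempty-member : ∀ {A : Set} (xs : List A) → 1 ≤ length xs → Σ A (_∈ xs)
nonempty-member (x ∷ _) _ = x , here refl

AllPairs-++⁻ : ∀ {A : Set} {R : A → A → Set} xs {ys} → AllPairs R (xs ++ ys) → AllPairs R xs × AllPairs R ys
AllPairs-++⁻ []       rs       = [] , rs
AllPairs-++⁻ (x ∷ xs) (r ∷ rs) = (All.++⁻ˡ xs r ∷ proj₁ (AllPairs-++⁻ xs rs)) , proj₂ (AllPairs-++⁻ xs rs)

filter-++-keepˡ : ∀ {A : Set} {P : A → Set} (P? : Decidable P) {ys zs} →
  All P ys → All (λ z → ¬ P z) zs → filter P? (ys ++ zs) ≡ ys
filter-++-keepˡ P? {ys} {zs} all none =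
  trans (filter-++ P? ys zs) (trans (cong₂ _++_ (filter-all P? all) (filter-none P? none)) (++-identityʳ ys))

filter-++-keepʳ : ∀ {A : Set} {P : A → Set} (P? : Decidable P) {ys zs} →
  All (λ y → ¬ P y) ys → All P zs → filter P? (ys ++ zs) ≡ zs
filter-++-keepʳ P? {ys} {zs} none all =
  trans (filter-++ P? ys zs) (cong₂ _++_ (filter-none P? none) (filter-all P? all))

length-filter-split : ∀ {A : Set} {P Q : A → Set} (P? : Decidable P) (Q? : Decidable Q) xs →
  All (λ x → ¬ P x → Q x) xs → All (λ x → P x → ¬ Q x) xs →
  length (filter P? xs) + length (filter Q? xs) ≡ length xs
length-filter-split P? Q? []       _        _        = refl
length-filter-split P? Q? (x ∷ xs) (c ∷ cs) (d ∷ ds) with P? x | Q? x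
... | yes p | yes q = ⊥-elim (d p q)
... | yes _ | no _  = cong suc (length-filter-split P? Q? xs cs ds)
... | no _  | yes _ = trans (+-suc _ _) (cong suc (length-filter-split P? Q? xs cs ds))
... | no p  | no q  = ⊥-elim (q (c p))

member-before : ∀ {A : Set} {P : A → Set} (P? : Decidable P) i u zs →
  2 ≤ length (filter P? (i ++ u ∷ zs)) → All (λ z → ¬ P z) zs → Σ A λ v → v ∈ i × P v
member-before P? i u zs 2≤ none = map₂ (∈-filter⁻ P? {xs = i}) (nonempty-member (filter P? i) 1≤)
  where
  open ≤-Reasoning
  rest≤1 : length (filter P? (u ∷ zs)) ≤ 1
  rest≤1 = subst (λ l → length l ≤ 1)
    (sym (trans (filter-++ P? (u ∷ []) zs) (trans (cong (filter P? (u ∷ []) ++_) (filter-none P? none)) (++-identityʳ _))))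
    (length-filter P? (u ∷ []))
  1≤ : 1 ≤ length (filter P? i)
  1≤ = +-cancelʳ-≤ 1 1 _ (begin
    2                                                    ≤⟨ 2≤ ⟩
    length (filter P? (i ++ u ∷ zs))                     ≡⟨ cong length (filter-++ P? i (u ∷ zs)) ⟩
    length (filter P? i ++ filter P? (u ∷ zs))           ≡⟨ length-++ (filter P? i) ⟩
    length (filter P? i) + length (filter P? (u ∷ zs))   ≤⟨ +-monoʳ-≤ _ rest≤1 ⟩
    length (filter P? i) + 1                             ∎)

record LastFailure {A : Set} (P : A → Set) (xs : List A) : Set where
  constructor lastFailure
  field
    init        : List A
    pivot       : A
    run         : List A
    split       : xs ≡ init ++ pivot ∷ run
    pivot-fails : ¬ P pivot
    run-holds   : All P run

all-or-last-failure : ∀ {A : Set} {P : A → Set} (P? : Decidable P) xs → All P xs ⊎ LastFailure P xs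
all-or-last-failure P? [] = inj₁ []
all-or-last-failure P? (x ∷ xs) with all-or-last-failure P? xs
... | inj₂ (lastFailure i u zs refl ¬Pu all) = inj₂ (lastFailure (x ∷ i) u zs refl ¬Pu all)
... | inj₁ all with P? x
...   | yes Px = inj₁ (Px ∷ all)
...   | no ¬Px = inj₂ (lastFailure [] x xs refl ¬Px all)

-- Counting distinct naturals in an interval

m≤n∧o≤p∧m+o≡n+p⇒m≡n×o≡p : ∀ {m n o p} → m ≤ n → o ≤ p → m + o ≡ n + p → m ≡ n × o ≡ p
m≤n∧o≤p∧m+o≡n+p⇒m≡n×o≡p {m} {n} {o} {p} m≤n o≤p eq =
  ≤-antisym m≤n (+-cancelʳ-≤ p n m (subst (_≤ m + p) eq (+-monoʳ-≤ m o≤p))) ,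
  ≤-antisym o≤p (+-cancelˡ-≤ m p o (subst (m + p ≤_) (sym eq) (+-monoˡ-≤ p m≤n)))

InRange : ℕ → ℕ → ℕ → Set
InRange a b v = a ≤ v × v < b

unique-singleton : ∀ b (vs : List ℕ) → Unique vs → All (_≡ b) vs → length vs ≤ 1
unique-singleton b []           _                _                = z≤n
unique-singleton b (_ ∷ [])     _                _                = s≤s z≤n
unique-singleton b (_ ∷ _ ∷ _) ((x≢y ∷ _) ∷ _) (x≡b ∷ y≡b ∷ _) = ⊥-elim (x≢y (trans x≡b (sym y≡b)))

unique-inRange-length : ∀ a b (vs : List ℕ) → Unique vs → All (InRange a b) vs → length vs ≤ b ∸ a
unique-inRange-length a zero    []       _ _                  = z≤n
unique-inRange-length a zero    (_ ∷ _)  _ ((_ , ()) ∷ _)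
unique-inRange-length a (suc b) []       _ _                  = z≤n
unique-inRange-length a (suc b) (v ∷ vs) u (r@(a≤v , v≤b) ∷ rs) = begin
  length (v ∷ vs)                   ≡⟨ length-filter-split (_≟ b) (_<? b) (v ∷ vs) (All.map below (r ∷ rs))
                                         (All.map (λ _ v≡b v<b → <-irrefl v≡b v<b) (r ∷ rs)) ⟨
  length atB + length belowB        ≤⟨ +-mono-≤ (unique-singleton b atB (AllPairs.filter⁺ (_≟ b) u) (All.all-filter (_≟ b) (v ∷ vs)))
                                         (unique-inRange-length a b belowB (AllPairs.filter⁺ (_<? b) u)
                                           (All.zip (All.filter⁺ (_<? b) (All.map proj₁ (r ∷ rs)) , All.all-filter (_<? b) (v ∷ vs)))) ⟩
  1 + (b ∸ a)                       ≡⟨ +-∸-assoc 1 (≤-trans a≤v (s≤s⁻¹ v≤b)) ⟨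
  suc b ∸ a                         ∎
  where
  open ≤-Reasoning
  atB belowB : List ℕ
  atB    = filter (_≟ b) (v ∷ vs)
  belowB = filter (_<? b) (v ∷ vs)
  below : ∀ {x} → InRange a (suc b) x → x ≢ b → x < b
  below (_ , x<1+b) x≢b = ≤∧≢⇒< (s≤s⁻¹ x<1+b) x≢b

∸-gap : ∀ {a t b} → a ≤ t → t < b → (t ∸ a) + (b ∸ suc t) < b ∸ a
∸-gap {a} a≤t t<b with i , refl ← m≤n⇒∃[o]m+o≡n a≤t | k , refl ← m≤n⇒∃[o]m+o≡n t<b =
  subst₂ _<_ (sym (cong₂ _+_ (m+n∸m≡n a i) (m+n∸m≡n (suc (a + i)) k))) (sym b∸a) (n<1+n (i + k))
  where
  b∸a : suc (a + i) + k ∸ a ≡ suc (i + k)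
  b∸a = trans (cong (_∸ a) (trans (cong suc (+-assoc a i k)) (sym (+-suc a (i + k))))) (m+n∸m≡n a (suc (i + k)))

unique-inRange-complete : ∀ a b (vs : List ℕ) → Unique vs → All (InRange a b) vs → b ∸ a ≤ length vs →
  ∀ {t} → a ≤ t → t < b → t ∈ vs
unique-inRange-complete a b vs u rs enough {t} a≤t t<b with t ∈? vs
... | yes t∈ = t∈
... | no t∉ = ⊥-elim (<⇒≱ (∸-gap a≤t t<b) (begin
  b ∸ a                         ≤⟨ enough ⟩
  length vs                     ≡⟨ length-filter-split (_<? t) (t <?_) vs (All.tabulate above) (All.map (λ _ → <-asym) rs) ⟨
  length lower + length upper   ≤⟨ +-mono-≤
                                     (unique-inRange-length a t lower (AllPairs.filter⁺ (_<? t) u)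
                                       (All.zip (All.map proj₁ (All.filter⁺ (_<? t) rs) , All.all-filter (_<? t) vs)))
                                     (unique-inRange-length (suc t) b upper (AllPairs.filter⁺ (t <?_) u)
                                       (All.zip (All.all-filter (t <?_) vs , All.map proj₂ (All.filter⁺ (t <?_) rs)))) ⟩
  (t ∸ a) + (b ∸ suc t)         ∎))
  where
  open ≤-Reasoning
  lower upper : List ℕ
  lower = filter (_<? t) vs
  upper = filter (t <?_) vs
  above : ∀ {v} → v ∈ vs → ¬ v < t → t < v
  above {v} v∈ v≮t with <-cmp v t
  ... | tri< v<t _ _ = ⊥-elim (v≮t v<t)
  ... | tri≈ _ refl _ = ⊥-elim (t∉ v∈)
  ... | tri> _ _ t<v = t<v

ordered-partition-intervals : ∀ n (ks ls : List ℕ) → Unique ks → Unique ls →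
  All (_< n) ks → All (_< n) ls → length ks + length ls ≡ n →
  (∀ {k l} → k ∈ ks → l ∈ ls → k < l) →
  (∀ {t} → t < length ks → t ∈ ks) × (∀ {t} → length ks ≤ t → t < n → t ∈ ls)
ordered-partition-intervals n ks ls uk ul ks<n ls<n len k<l = ks-complete , ls-complete
  where
  j : ℕ
  j = length ks
  |ls|≡ : length ls ≡ n ∸ j
  |ls|≡ = trans (sym (m+n∸m≡n j (length ls))) (cong (_∸ j) len)
  ks<j : ∀ {k} → k ∈ ks → k < j
  ks<j {k} k∈ with k <? j
  ... | yes k<j = k<j
  ... | no k≮j = ⊥-elim (<-irrefl |ls|≡ (begin-strict
    length ls      ≤⟨ unique-inRange-length (suc k) n ls ul (All.tabulate (λ l∈ → k<l k∈ l∈ , All.lookup ls<n l∈)) ⟩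
    n ∸ suc k      ≤⟨ ∸-monoʳ-≤ n (s≤s (≮⇒≥ k≮j)) ⟩
    n ∸ suc j      <⟨ ∸-monoʳ-< (n<1+n j) (≤-<-trans (≮⇒≥ k≮j) (All.lookup ks<n k∈)) ⟩
    n ∸ j          ∎))
    where open ≤-Reasoning
  ks-complete : ∀ {t} → t < j → t ∈ ks
  ks-complete = unique-inRange-complete 0 j ks uk (All.tabulate (λ k∈ → z≤n , ks<j k∈)) ≤-refl z≤n
  ls≥j : ∀ {l} → l ∈ ls → j ≤ l
  ls≥j {l} l∈ with l <? j
  ... | no l≮j = ≮⇒≥ l≮j
  ... | yes l<j = ⊥-elim (<-irrefl refl (k<l (ks-complete l<j) l∈))
  ls-complete : ∀ {t} → j ≤ t → t < n → t ∈ ls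
  ls-complete = unique-inRange-complete j n ls ul (All.tabulate (λ l∈ → ls≥j l∈ , All.lookup ls<n l∈)) (≤-reflexive (sym |ls|≡))

-- Sums of permutations

_⊕₂_ : List ℕ → List ℕ → List ℕ
σ ⊕₂ ρ = σ ++ map (length σ +_) ρ

length-⊕₂ : ∀ σ ρ → length (σ ⊕₂ ρ) ≡ length σ + length ρ
length-⊕₂ σ ρ = trans (length-++ σ) (cong (length σ +_) (length-map _ ρ))

nth-⊕₂ʳ : ∀ σ ρ {t} → t < length ρ → nth (σ ⊕₂ ρ) (length σ + t) ≡ length σ + nth ρ t
nth-⊕₂ʳ σ ρ {t} t< = trans (nth-++ʳ σ _ t) (nth-map _ ρ t<)

⊕-++ : ∀ σs ρs → ⊕ (σs ++ ρs) ≡ ⊕ σs ⊕₂ ⊕ ρs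
⊕-++ []       ρs = sym (map-id (⊕ ρs))
⊕-++ (σ ∷ σs) ρs = begin
  σ ++ map (length σ +_) (⊕ (σs ++ ρs))
    ≡⟨ cong (λ l → σ ++ map (length σ +_) l) (⊕-++ σs ρs) ⟩
  σ ++ map (length σ +_) (⊕ σs ++ map (length (⊕ σs) +_) (⊕ ρs))
    ≡⟨ cong (σ ++_) (map-++ (length σ +_) (⊕ σs) _) ⟩
  σ ++ (map (length σ +_) (⊕ σs) ++ map (length σ +_) (map (length (⊕ σs) +_) (⊕ ρs)))
    ≡⟨ cong (λ l → σ ++ (map (length σ +_) (⊕ σs) ++ l)) (trans (sym (map-∘ (⊕ ρs))) (map-cong shift (⊕ ρs))) ⟩
  σ ++ (map (length σ +_) (⊕ σs) ++ map (length (σ ++ map (length σ +_) (⊕ σs)) +_) (⊕ ρs))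
    ≡⟨ ++-assoc σ _ _ ⟨
  (σ ++ map (length σ +_) (⊕ σs)) ⊕₂ ⊕ ρs ∎
  where
  open ≡-Reasoning
  shift : ∀ v → length σ + (length (⊕ σs) + v) ≡ length (σ ++ map (length σ +_) (⊕ σs)) + v
  shift v = trans (sym (+-assoc (length σ) _ v)) (cong (_+ v) (sym (length-⊕₂ σ (⊕ σs))))

⊕-∷ʳ : ∀ σs ρ → ⊕ (σs ++ ρ ∷ []) ≡ ⊕ σs ⊕₂ ρ
⊕-∷ʳ σs ρ = trans (⊕-++ σs (ρ ∷ [])) (cong (⊕ σs ⊕₂_) (++-identityʳ ρ))

Bounded : List ℕ → Set
Bounded σ = ∀ {v} → v ∈ σ → v < length σ

isPerm⇒bounded : ∀ {σ} → IsPerm σ → Bounded σ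
isPerm⇒bounded σ↭ v∈ = ∈-upTo⁻ (∈-resp-↭ σ↭ v∈)

isPerm⇒∈ : ∀ {σ} → IsPerm σ → ∀ {v} → v < length σ → v ∈ σ
isPerm⇒∈ σ↭ v< = ∈-resp-↭ (↭-sym σ↭) (∈-upTo⁺ v<)

bounded-⊕₂ : ∀ {σ ρ} → Bounded σ → Bounded ρ → Bounded (σ ⊕₂ ρ)
bounded-⊕₂ {σ} {ρ} bσ bρ v∈ rewrite length-⊕₂ σ ρ with ∈-++⁻ σ v∈
... | inj₁ v∈σ = ≤-trans (bσ v∈σ) (m≤m+n _ _)
... | inj₂ v∈ρ with w , w∈ , refl ← ∈-map⁻ (length σ +_) v∈ρ = +-monoʳ-< (length σ) (bρ w∈)

bounded-⊕ : ∀ {σs} → All Bounded σs → Bounded (⊕ σs)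
bounded-⊕ []       ()
bounded-⊕ (b ∷ bs) = bounded-⊕₂ b (bounded-⊕ bs)

SplitsAt : List ℕ → ℕ → Set
SplitsAt σ j = ∀ {t t′} → t < j → j ≤ t′ → t′ < length σ → nth σ t < nth σ t′

record ⊕-Indecomposable (σ : List ℕ) : Set where
  field
    bounded      : Bounded σ
    nonempty     : 1 ≤ length σ
    unsplittable : ∀ {j} → 1 ≤ j → j < length σ → ¬ SplitsAt σ j

open ⊕-Indecomposable public

∈-take⊎∈-drop : ∀ j (σ : List ℕ) {x} → x ∈ σ → x ∈ take j σ ⊎ x ∈ drop j σ
∈-take⊎∈-drop j σ {x} x∈ = ∈-++⁻ (take j σ) (subst (x ∈_) (sym (take++drop≡id j σ)) x∈)

prefix-contiguous : ∀ {σ j} → IsPerm σ → j < length σ → SplitsAt σ j → Contiguous (take j σ)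
prefix-contiguous {σ} {j} σ↭ j<n split u v x u∈ v∈ u≤x x≤v
  with tv , tv<j , refl ← ∈-take⇒nth j σ v∈
  with ∈-take⊎∈-drop j σ (isPerm⇒∈ σ↭ (≤-<-trans x≤v (isPerm⇒bounded σ↭ (nth-∈ σ (<-trans tv<j j<n)))))
... | inj₁ x∈ = x∈
... | inj₂ x∈ with tx , j≤tx , tx<n , refl ← ∈-drop⇒nth j σ x∈ = ⊥-elim (<⇒≱ (split tv<j j≤tx tx<n) x≤v)

suffix-contiguous : ∀ {σ j} → IsPerm σ → SplitsAt σ j → Contiguous (drop j σ)
suffix-contiguous {σ} {j} σ↭ split u v x u∈ v∈ u≤x x≤v
  with tu , j≤tu , tu<n , refl ← ∈-drop⇒nth j σ u∈ | tv , _ , tv<n , refl ← ∈-drop⇒nth j σ v∈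
  with ∈-take⊎∈-drop j σ (isPerm⇒∈ σ↭ (≤-<-trans x≤v (isPerm⇒bounded σ↭ (nth-∈ σ tv<n))))
... | inj₂ x∈ = x∈
... | inj₁ x∈ with tx , tx<j , refl ← ∈-take⇒nth j σ x∈ = ⊥-elim (<⇒≱ (split tx<j j≤tu tu<n) u≤x)

simple⇒⊕-indecomposable : ∀ {σ} → IsPerm σ → Simple σ → 3 ≤ length σ → ⊕-Indecomposable σ
simple⇒⊕-indecomposable {σ} σ↭ simple 3≤n = record
  { bounded = isPerm⇒bounded σ↭ ; nonempty = ≤-trans (s≤s z≤n) 3≤n ; unsplittable = unsplittable′ }
  where
  length-take-< : ∀ {k} → k < length σ → length (take k σ) ≡ k
  length-take-< {k} k<n = trans (length-take k σ) (m≤n⇒m⊓n≡m (<⇒≤ k<n))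
  unsplittable′ : ∀ {j} → 1 ≤ j → j < length σ → ¬ SplitsAt σ j
  unsplittable′ {suc zero} _ j<n split
    with simple (take 1 σ) (drop 1 σ) [] (sym (trans (cong (take 1 σ ++_) (++-identityʳ _)) (take++drop≡id 1 σ)))
                (suffix-contiguous σ↭ split)
  ... | inj₁ ≤1 = <⇒≱ (∸-monoˡ-≤ 1 3≤n) (subst (_≤ 1) (length-drop 1 σ) ≤1)
  ... | inj₂ ≡n = <-irrefl (trans (sym (length-drop 1 σ)) ≡n) (∸-monoʳ-< {o = 0} (s≤s z≤n) (≤-trans (s≤s z≤n) 3≤n))
  unsplittable′ {suc (suc j)} _ j<n split
    with simple [] (take (2 + j) σ) (drop (2 + j) σ) (sym (take++drop≡id (2 + j) σ)) (prefix-contiguous σ↭ j<n split)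
  ... | inj₁ ≤1 = <⇒≱ (s≤s (s≤s z≤n)) (subst (_≤ 1) (length-take-< j<n) ≤1)
  ... | inj₂ ≡n = <-irrefl (trans (sym (length-take-< j<n)) ≡n) j<n

-- Covers 1, 21, 231 and 312: in none of them is the first entry below the last.
first≮last⇒⊕-indecomposable : ∀ {σ ℓ} → IsPerm σ → suc ℓ ≡ length σ → ¬ nth σ 0 < nth σ ℓ → ⊕-Indecomposable σ
first≮last⇒⊕-indecomposable {σ} σ↭ n≡ first≮last = record
  { bounded = isPerm⇒bounded σ↭ ; nonempty = subst (1 ≤_) n≡ (s≤s z≤n) ; unsplittable = unsplittable′ }
  where
  unsplittable′ : ∀ {j} → 1 ≤ j → j < length σ → ¬ SplitsAt σ j
  unsplittable′ 1≤j j<n split = first≮last (split 1≤j (s≤s⁻¹ (subst (_ <_) (sym n≡) j<n)) (subst (_ <_) n≡ ≤-refl))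

incOsc⇒⊕-indecomposable : ∀ {σ} → IncreasingOscillation σ → ⊕-Indecomposable σ
incOsc⇒⊕-indecomposable (σ↭ , inj₁ refl)                         = first≮last⇒⊕-indecomposable σ↭ refl λ ()
incOsc⇒⊕-indecomposable (σ↭ , inj₂ (inj₁ refl))                  = first≮last⇒⊕-indecomposable σ↭ refl λ ()
incOsc⇒⊕-indecomposable (σ↭ , inj₂ (inj₂ (inj₁ refl)))           = first≮last⇒⊕-indecomposable σ↭ refl λ ()
incOsc⇒⊕-indecomposable (σ↭ , inj₂ (inj₂ (inj₂ (inj₁ refl))))    = first≮last⇒⊕-indecomposable σ↭ refl λ { (s≤s ()) }
incOsc⇒⊕-indecomposable (σ↭ , inj₂ (inj₂ (inj₂ (inj₂ (4≤n , simple , _))))) =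
  simple⇒⊕-indecomposable σ↭ simple (≤-trans (n≤1+n 3) 4≤n)

length≤length-⊕ : ∀ ξs → All (λ ξ → 1 ≤ length ξ) ξs → length ξs ≤ length (⊕ ξs)
length≤length-⊕ []       []         = z≤n
length≤length-⊕ (ξ ∷ ξs) (1≤ξ ∷ 1≤) =
  subst (suc (length ξs) ≤_) (sym (length-⊕₂ ξ (⊕ ξs))) (+-mono-≤ 1≤ξ (length≤length-⊕ ξs 1≤))

2≤length-⊕ : ∀ {ξs} → All ⊕-Indecomposable ξs → 2 ≤ length ξs → 2 ≤ length (⊕ ξs)
2≤length-⊕ {ξs} inds 2≤ = ≤-trans 2≤ (length≤length-⊕ ξs (All.map nonempty inds))

-- Drawings of permutations

-- A point labelled with the column of σ at which it is drawn. Unlike the Fin-indexed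
-- FormsPerm, such labellings can be restricted to sublists and concatenated, which is
-- how drawings of σ ⊕ ρ are split and glued.
Labelled : Set
Labelled = Point × ℕ

pt : Labelled → Point
pt = proj₁

col : Labelled → ℕ
col = proj₂

_≺_ : Point → Point → Set
p ≺ q = px p < px q × py p < py q

≺-trans : ∀ {p q r} → p ≺ q → q ≺ r → p ≺ r
≺-trans (x₁ , y₁) (x₂ , y₂) = <-trans x₁ x₂ , <-trans y₁ y₂

record Coherent (σ : List ℕ) (a b : Labelled) : Set where
  field
    x→col : px (pt a) < px (pt b) → col a < col b
    col→x : col a < col b → px (pt a) < px (pt b)
    y→val : py (pt a) < py (pt b) → nth σ (col a) < nth σ (col b)
    val→y : nth σ (col a) < nth σ (col b) → py (pt a) < py (pt b)

open Coherent public

record Draws (xs : List Labelled) (σ : List ℕ) : Set where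
  field
    length≡  : length xs ≡ length σ
    col<     : ∀ {a} → a ∈ xs → col a < length σ
    coherent : ∀ {a b} → a ∈ xs → b ∈ xs → Coherent σ a b

open Draws public

DistinctPoints : List Labelled → Set
DistinctPoints = AllPairs (λ a b → pt a ≢ pt b)

DistinctCols : List Labelled → Set
DistinctCols = AllPairs (λ a b → col a ≢ col b)

private
  index : ∀ {A B : Set} (f : A → B) (xs : List A) → Fin (length (map f xs)) → Fin (length xs)
  index f (x ∷ xs) Fin.zero    = Fin.zero
  index f (x ∷ xs) (Fin.suc i) = Fin.suc (index f xs i)

  lookup-map : ∀ {A B : Set} (f : A → B) (xs : List A) i → lookup (map f xs) i ≡ f (lookup xs (index f xs i))
  lookup-map f (x ∷ xs) Fin.zero    = refl
  lookup-map f (x ∷ xs) (Fin.suc i) = lookup-map f xs i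

formsPerm⇒draws : ∀ {ps σ} → FormsPerm ps σ → Σ (List Labelled) λ xs → map pt xs ≡ ps × Draws xs σ
formsPerm⇒draws {ps} {σ} (τ , len , orders) = xs , pts , record
  { length≡ = trans (length-tabulate label) len ; col< = col<′ ; coherent = coherent′ }
  where
  label : Fin (length ps) → Labelled
  label i = lookup ps i , toℕ (τ i)
  xs : List Labelled
  xs = tabulate label
  pts : map pt xs ≡ ps
  pts = trans (map-tabulate label pt) (tabulate-lookup ps)
  col<′ : ∀ {a} → a ∈ xs → col a < length σ
  col<′ a∈ with i , refl ← ∈-tabulate⁻ a∈ = toℕ<n (τ i)
  coherent′ : ∀ {a b} → a ∈ xs → b ∈ xs → Coherent σ a b
  coherent′ a∈ b∈ with i , refl ← ∈-tabulate⁻ a∈ | j , refl ← ∈-tabulate⁻ b∈ = record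
    { x→col = Equivalence.to (proj₁ (orders i j))
    ; col→x = Equivalence.from (proj₁ (orders i j))
    ; y→val = λ h → subst₂ _<_ (sym (nth-lookup σ (τ i))) (sym (nth-lookup σ (τ j))) (Equivalence.to (proj₂ (orders i j)) h)
    ; val→y = λ h → Equivalence.from (proj₂ (orders i j)) (subst₂ _<_ (nth-lookup σ (τ i)) (nth-lookup σ (τ j)) h)
    }

draws⇒formsPerm : ∀ {xs σ} → Draws xs σ → FormsPerm (map pt xs) σ
draws⇒formsPerm {xs} {σ} d = τ , trans (length-map pt xs) (length≡ d) , orders
  where
  at : Fin (length (map pt xs)) → Labelled
  at i = lookup xs (index pt xs i)
  at∈ : ∀ i → at i ∈ xs
  at∈ i = ∈-lookup {xs = xs} (index pt xs i)
  τ : Fin (length (map pt xs)) → Fin (length σ)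
  τ i = fromℕ< (col< d (at∈ i))
  toℕ-τ : ∀ i → toℕ (τ i) ≡ col (at i)
  toℕ-τ i = toℕ-fromℕ< (col< d (at∈ i))
  lookup-τ : ∀ i → lookup σ (τ i) ≡ nth σ (col (at i))
  lookup-τ i = trans (sym (nth-lookup σ (τ i))) (cong (nth σ) (toℕ-τ i))
  orders : ∀ i j → (px (lookup (map pt xs) i) < px (lookup (map pt xs) j) ⇔ Fin._<_ (τ i) (τ j))
                  × (py (lookup (map pt xs) i) < py (lookup (map pt xs) j) ⇔ lookup σ (τ i) < lookup σ (τ j))
  orders i j rewrite lookup-map pt xs i | lookup-map pt xs j =
    mk⇔ (λ h → subst₂ _<_ (sym (toℕ-τ i)) (sym (toℕ-τ j)) (x→col c h))
        (λ h → col→x c (subst₂ _<_ (toℕ-τ i) (toℕ-τ j) h)) ,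
    mk⇔ (λ h → subst₂ _<_ (sym (lookup-τ i)) (sym (lookup-τ j)) (y→val c h))
        (λ h → val→y c (subst₂ _<_ (lookup-τ i) (lookup-τ j) h))
    where c = coherent d (at∈ i) (at∈ j)

draws-resp-↭ : ∀ {xs ys σ} → xs ↭ ys → Draws xs σ → Draws ys σ
draws-resp-↭ {xs} {ys} xs↭ys d = record
  { length≡  = trans (sym (↭-length xs↭ys)) (length≡ d)
  ; col<     = λ a∈ → col< d (back a∈)
  ; coherent = λ a∈ b∈ → coherent d (back a∈) (back b∈)
  }
  where
  back : ∀ {a} → a ∈ ys → a ∈ xs
  back = ∈-resp-↭ (↭-sym xs↭ys)

coherent-col-injective : ∀ {σ a b} → Coherent σ a b → Coherent σ b a → col a ≡ col b → pt a ≡ pt b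
coherent-col-injective {σ} {a} {b} ab ba eq = cong₂ _,_ x≡ y≡
  where
  x≡ : px (pt a) ≡ px (pt b)
  x≡ with <-cmp (px (pt a)) (px (pt b))
  ... | tri< lt _ _ = ⊥-elim (<-irrefl eq (x→col ab lt))
  ... | tri≈ _ e _  = e
  ... | tri> _ _ gt = ⊥-elim (<-irrefl (sym eq) (x→col ba gt))
  y≡ : py (pt a) ≡ py (pt b)
  y≡ with <-cmp (py (pt a)) (py (pt b))
  ... | tri< lt _ _ = ⊥-elim (<-irrefl (cong (nth σ) eq) (y→val ab lt))
  ... | tri≈ _ e _  = e
  ... | tri> _ _ gt = ⊥-elim (<-irrefl (cong (nth σ) (sym eq)) (y→val ba gt))

distinctPoints⇒distinctCols : ∀ {xs σ} → (∀ {a b} → a ∈ xs → b ∈ xs → Coherent σ a b) →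
  DistinctPoints xs → DistinctCols xs
distinctPoints⇒distinctCols {xs} {σ} coh = go xs (λ {a} a∈ → a∈)
  where
  col≢ : ∀ {a b} → a ∈ xs → b ∈ xs → pt a ≢ pt b → col a ≢ col b
  col≢ a∈ b∈ pt≢ eq = pt≢ (coherent-col-injective (coh a∈ b∈) (coh b∈ a∈) eq)
  go : ∀ ys → (∀ {a} → a ∈ ys → a ∈ xs) → DistinctPoints ys → DistinctCols ys
  go []       _   []         = []
  go (y ∷ ys) sub (y≢ ∷ ys≢) =
    All.tabulate (λ z∈ → col≢ (sub (here refl)) (sub (there z∈)) (All.lookup y≢ z∈)) ∷ go ys (λ {a} a∈ → sub (there a∈)) ys≢

≺-partition-impossible : ∀ {σ ys zs y z} → ⊕-Indecomposable σ → Draws (ys ++ zs) σ →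
  DistinctPoints ys → DistinctPoints zs → y ∈ ys → z ∈ zs → (∀ {z y} → z ∈ zs → y ∈ ys → pt z ≺ pt y) → ⊥
≺-partition-impossible {σ} {ys} {zs} ind d dpy dpz y∈ z∈ zs≺ys =
  unsplittable ind (subst (1 ≤_) (sym (length-map col zs)) (∈⇒nonempty z∈)) j<n split
  where
  n : ℕ
  n = length σ
  ks ls : List ℕ
  ks = map col zs
  ls = map col ys
  inY : ∀ {a} → a ∈ ys → a ∈ ys ++ zs
  inY = ∈-++⁺ˡ
  inZ : ∀ {a} → a ∈ zs → a ∈ ys ++ zs
  inZ = ∈-++⁺ʳ ys
  |ks|+|ls| : length ks + length ls ≡ n
  |ks|+|ls| = begin
    length ks + length ls ≡⟨ cong₂ _+_ (length-map col zs) (length-map col ys) ⟩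
    length zs + length ys ≡⟨ +-comm (length zs) (length ys) ⟩
    length ys + length zs ≡⟨ length-++ ys ⟨
    length (ys ++ zs)     ≡⟨ length≡ d ⟩
    n                     ∎
    where open ≡-Reasoning
  j<n : length ks < n
  j<n = subst (length ks <_) |ks|+|ls| (m<m+n (length ks) (subst (1 ≤_) (sym (length-map col ys)) (∈⇒nonempty y∈)))
  intervals : (∀ {t} → t < length ks → t ∈ ks) × (∀ {t} → length ks ≤ t → t < n → t ∈ ls)
  intervals = ordered-partition-intervals n ks ls
    (AllPairs.map⁺ (distinctPoints⇒distinctCols (λ a∈ b∈ → coherent d (inZ a∈) (inZ b∈)) dpz))
    (AllPairs.map⁺ (distinctPoints⇒distinctCols (λ a∈ b∈ → coherent d (inY a∈) (inY b∈)) dpy))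
    (All.map⁺ (All.tabulate (λ a∈ → col< d (inZ a∈)))) (All.map⁺ (All.tabulate (λ a∈ → col< d (inY a∈))))
    |ks|+|ls| k<l
    where
    k<l : ∀ {k l} → k ∈ ks → l ∈ ls → k < l
    k<l k∈ l∈ with _ , z∈ , refl ← ∈-map⁻ col k∈ | _ , y∈ , refl ← ∈-map⁻ col l∈ =
      x→col (coherent d (inZ z∈) (inY y∈)) (proj₁ (zs≺ys z∈ y∈))
  split : SplitsAt σ (length ks)
  split t<j j≤t′ t′<n
    with _ , z∈ , refl ← ∈-map⁻ col (proj₁ intervals t<j) | _ , y∈ , refl ← ∈-map⁻ col (proj₂ intervals j≤t′ t′<n) =
    y→val (coherent d (inZ z∈) (inY y∈)) (proj₂ (zs≺ys z∈ y∈))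

shiftCol unshiftCol : ℕ → Labelled → Labelled
shiftCol   s a = pt a , s + col a
unshiftCol s a = pt a , col a ∸ s

module ⊕₂-Split (σ ρ : List ℕ) (bσ : Bounded σ) {xs : List Labelled}
                (d : Draws xs (σ ⊕₂ ρ)) (dp : DistinctPoints xs) where

  private
    dc : DistinctCols xs
    dc = distinctPoints⇒distinctCols (coherent d) dp

  s : ℕ
  s = length σ

  Low High : Labelled → Set
  Low  a = col a < s
  High a = s ≤ col a

  low? : Decidable Low
  low? a = col a <? s

  high? : Decidable High
  high? a = s ≤? col a

  Lo Hi : List Labelled
  Lo = filter low? xs
  Hi = filter high? xs

  col<s+ : ∀ {a} → a ∈ xs → col a < s + length ρ
  col<s+ a∈ = subst (_ <_) (length-⊕₂ σ ρ) (col< d a∈)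

  nth-low : ∀ {t} → t < s → nth (σ ⊕₂ ρ) t ≡ nth σ t
  nth-low = nth-++ˡ σ _

  nth-high : ∀ {a} → a ∈ xs → High a → nth (σ ⊕₂ ρ) (col a) ≡ s + nth ρ (col a ∸ s)
  nth-high {a} a∈ s≤c = trans (cong (nth (σ ⊕₂ ρ)) (sym (m+[n∸m]≡n s≤c)))
    (nth-⊕₂ʳ σ ρ (subst (col a ∸ s <_) (m+n∸m≡n s (length ρ)) (∸-monoˡ-< (col<s+ a∈) s≤c)))

  low≺high : ∀ {a b} → a ∈ xs → b ∈ xs → Low a → High b → pt a ≺ pt b
  low≺high {a} {b} a∈ b∈ a-low b-high =
    col→x (coherent d a∈ b∈) (<-≤-trans a-low b-high) ,
    val→y (coherent d a∈ b∈) (subst₂ _<_ (sym (nth-low a-low)) (sym (nth-high b∈ b-high))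
      (<-≤-trans (bσ (nth-∈ σ a-low)) (m≤m+n s _)))

  private
    length-Lo≤ : length Lo ≤ s
    length-Lo≤ = subst (_≤ s) (length-map col Lo)
      (unique-inRange-length 0 s (map col Lo) (AllPairs.map⁺ (AllPairs.filter⁺ low? dc))
        (All.map⁺ (All.map (z≤n ,_) (All.all-filter low? xs))))

    length-Hi≤ : length Hi ≤ length ρ
    length-Hi≤ = subst₂ _≤_ (length-map col Hi) (m+n∸m≡n s (length ρ))
      (unique-inRange-length s (s + length ρ) (map col Hi) (AllPairs.map⁺ (AllPairs.filter⁺ high? dc))
        (All.map⁺ (All.zip (All.all-filter high? xs , All.filter⁺ high? (All.tabulate col<s+)))))

    length-Lo+Hi : length Lo + length Hi ≡ s + length ρ
    length-Lo+Hi = trans (length-filter-split low? high? xs (All.tabulate (λ _ → ≮⇒≥)) (All.tabulate (λ _ → <⇒≱)))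
                         (trans (length≡ d) (length-⊕₂ σ ρ))

  length-Lo : length Lo ≡ s
  length-Lo = proj₁ (m≤n∧o≤p∧m+o≡n+p⇒m≡n×o≡p length-Lo≤ length-Hi≤ length-Lo+Hi)

  length-Hi : length Hi ≡ length ρ
  length-Hi = proj₂ (m≤n∧o≤p∧m+o≡n+p⇒m≡n×o≡p length-Lo≤ length-Hi≤ length-Lo+Hi)

  draws-Lo : Draws Lo σ
  draws-Lo = record { length≡ = length-Lo ; col< = λ a∈ → proj₂ (∈-filter⁻ low? {xs = xs} a∈) ; coherent = coh }
    where
    coh : ∀ {a b} → a ∈ Lo → b ∈ Lo → Coherent σ a b
    coh a∈ b∈ with a∈xs , a-low ← ∈-filter⁻ low? {xs = xs} a∈ | b∈xs , b-low ← ∈-filter⁻ low? {xs = xs} b∈ = record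
      { x→col = x→col c
      ; col→x = col→x c
      ; y→val = λ h → subst₂ _<_ (nth-low a-low) (nth-low b-low) (y→val c h)
      ; val→y = λ h → val→y c (subst₂ _<_ (sym (nth-low a-low)) (sym (nth-low b-low)) h)
      }
      where c = coherent d a∈xs b∈xs

  draws-Hi : Draws (map (unshiftCol s) Hi) ρ
  draws-Hi = record { length≡ = trans (length-map _ Hi) length-Hi ; col< = col<′ ; coherent = coh }
    where
    col<′ : ∀ {a} → a ∈ map (unshiftCol s) Hi → col a < length ρ
    col<′ a∈ with a′ , a′∈ , refl ← ∈-map⁻ (unshiftCol s) a∈ with a∈xs , s≤c ← ∈-filter⁻ high? {xs = xs} a′∈ =
      subst (_ <_) (m+n∸m≡n s (length ρ)) (∸-monoˡ-< (col<s+ a∈xs) s≤c)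
    coh : ∀ {a b} → a ∈ map (unshiftCol s) Hi → b ∈ map (unshiftCol s) Hi → Coherent ρ a b
    coh a∈ b∈ with a′ , a′∈ , refl ← ∈-map⁻ (unshiftCol s) a∈ | b′ , b′∈ , refl ← ∈-map⁻ (unshiftCol s) b∈
      with a∈xs , s≤a ← ∈-filter⁻ high? {xs = xs} a′∈ | b∈xs , s≤b ← ∈-filter⁻ high? {xs = xs} b′∈ = record
      { x→col = λ h → ∸-monoˡ-< (x→col c h) s≤a
      ; col→x = λ h → col→x c (subst₂ _<_ (m+[n∸m]≡n s≤a) (m+[n∸m]≡n s≤b) (+-monoʳ-< s h))
      ; y→val = λ h → +-cancelˡ-< s _ _ (subst₂ _<_ (nth-high a∈xs s≤a) (nth-high b∈xs s≤b) (y→val c h))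
      ; val→y = λ h → val→y c (subst₂ _<_ (sym (nth-high a∈xs s≤a)) (sym (nth-high b∈xs s≤b)) (+-monoʳ-< s h))
      }
      where c = coherent d a∈xs b∈xs

  ∃-low : 1 ≤ s → Σ Labelled λ a → a ∈ xs × Low a
  ∃-low 1≤s = map₂ (∈-filter⁻ low? {xs = xs}) (nonempty-member Lo (subst (1 ≤_) (sym length-Lo) 1≤s))

  ∃-high : 1 ≤ length ρ → Σ Labelled λ a → a ∈ xs × High a
  ∃-high 1≤ρ = map₂ (∈-filter⁻ high? {xs = xs}) (nonempty-member Hi (subst (1 ≤_) (sym length-Hi) 1≤ρ))

  high-before : ∀ {i u zs} → xs ≡ i ++ u ∷ zs → All Low zs → 2 ≤ length ρ → Σ Labelled λ v → v ∈ i × High v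
  high-before {i} {u} {zs} refl zs-low 2≤ρ =
    member-before high? i u zs (subst (2 ≤_) (sym length-Hi) 2≤ρ) (All.map <⇒≱ zs-low)

  low-before : ∀ {i u zs} → xs ≡ i ++ u ∷ zs → All High zs → 2 ≤ s → Σ Labelled λ v → v ∈ i × Low v
  low-before {i} {u} {zs} refl zs-high 2≤s =
    member-before low? i u zs (subst (2 ≤_) (sym length-Lo) 2≤s) (All.map (λ s≤c c<s → <⇒≱ c<s s≤c) zs-high)

module _ {σ ρ A B} (bσ : Bounded σ) (dA : Draws A σ) (dB : Draws B ρ)
         (A≺B : ∀ {a b} → a ∈ A → b ∈ B → pt a ≺ pt b) where

  private
    s : ℕ
    s = length σ

    nth-A : ∀ {a} → a ∈ A → nth (σ ⊕₂ ρ) (col a) ≡ nth σ (col a)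
    nth-A a∈ = nth-++ˡ σ _ (col< dA a∈)

    nth-B : ∀ {b} → b ∈ B → nth (σ ⊕₂ ρ) (s + col b) ≡ s + nth ρ (col b)
    nth-B b∈ = nth-⊕₂ʳ σ ρ (col< dB b∈)

    A-val<s : ∀ {a} → a ∈ A → nth (σ ⊕₂ ρ) (col a) < s
    A-val<s a∈ = subst (_< s) (sym (nth-A a∈)) (bσ (nth-∈ σ (col< dA a∈)))

    s≤B-val : ∀ {b} → b ∈ B → s ≤ nth (σ ⊕₂ ρ) (s + col b)
    s≤B-val b∈ = subst (s ≤_) (sym (nth-B b∈)) (m≤m+n s _)

    coherent-AA : ∀ {a b} → a ∈ A → b ∈ A → Coherent (σ ⊕₂ ρ) a b
    coherent-AA a∈ b∈ = record
      { x→col = x→col c ; col→x = col→x c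
      ; y→val = λ h → subst₂ _<_ (sym (nth-A a∈)) (sym (nth-A b∈)) (y→val c h)
      ; val→y = λ h → val→y c (subst₂ _<_ (nth-A a∈) (nth-A b∈) h) }
      where c = coherent dA a∈ b∈

    coherent-BB : ∀ {a b} → a ∈ B → b ∈ B → Coherent (σ ⊕₂ ρ) (shiftCol s a) (shiftCol s b)
    coherent-BB a∈ b∈ = record
      { x→col = λ h → +-monoʳ-< s (x→col c h) ; col→x = λ h → col→x c (+-cancelˡ-< s _ _ h)
      ; y→val = λ h → subst₂ _<_ (sym (nth-B a∈)) (sym (nth-B b∈)) (+-monoʳ-< s (y→val c h))
      ; val→y = λ h → val→y c (+-cancelˡ-< s _ _ (subst₂ _<_ (nth-B a∈) (nth-B b∈) h)) }
      where c = coherent dB a∈ b∈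

    coherent-AB : ∀ {a b} → a ∈ A → b ∈ B → Coherent (σ ⊕₂ ρ) a (shiftCol s b)
    coherent-AB a∈ b∈ = record
      { x→col = λ _ → <-≤-trans (col< dA a∈) (m≤m+n s _) ; col→x = λ _ → proj₁ (A≺B a∈ b∈)
      ; y→val = λ _ → <-≤-trans (A-val<s a∈) (s≤B-val b∈) ; val→y = λ _ → proj₂ (A≺B a∈ b∈) }

    coherent-BA : ∀ {a b} → a ∈ B → b ∈ A → Coherent (σ ⊕₂ ρ) (shiftCol s a) b
    coherent-BA a∈ b∈ = record
      { x→col = λ h → ⊥-elim (<-asym h (proj₁ (A≺B b∈ a∈)))
      ; col→x = λ h → ⊥-elim (<-asym h (<-≤-trans (col< dA b∈) (m≤m+n s _)))
      ; y→val = λ h → ⊥-elim (<-asym h (proj₂ (A≺B b∈ a∈)))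
      ; val→y = λ h → ⊥-elim (<-asym h (<-≤-trans (A-val<s b∈) (s≤B-val a∈))) }

  draws-⊕₂ : Draws (A ++ map (shiftCol (length σ)) B) (σ ⊕₂ ρ)
  draws-⊕₂ = record { length≡ = length≡′ ; col< = col<′ ; coherent = coherent′ }
    where
    length≡′ : length (A ++ map (shiftCol s) B) ≡ length (σ ⊕₂ ρ)
    length≡′ = trans (length-++ A) (trans (cong₂ _+_ (length≡ dA) (trans (length-map _ B) (length≡ dB))) (sym (length-⊕₂ σ ρ)))
    col<′ : ∀ {a} → a ∈ A ++ map (shiftCol s) B → col a < length (σ ⊕₂ ρ)
    col<′ a∈ rewrite length-⊕₂ σ ρ with ∈-++⁻ A a∈
    ... | inj₁ a∈A = <-≤-trans (col< dA a∈A) (m≤m+n s _)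
    ... | inj₂ a∈B′ with b , b∈ , refl ← ∈-map⁻ (shiftCol s) a∈B′ = +-monoʳ-< s (col< dB b∈)
    coherent′ : ∀ {a b} → a ∈ A ++ map (shiftCol s) B → b ∈ A ++ map (shiftCol s) B → Coherent (σ ⊕₂ ρ) a b
    coherent′ a∈ b∈ with ∈-++⁻ A a∈ | ∈-++⁻ A b∈
    ... | inj₁ a∈A | inj₁ b∈A = coherent-AA a∈A b∈A
    ... | inj₁ a∈A | inj₂ b∈B′ with _ , b∈B , refl ← ∈-map⁻ (shiftCol s) b∈B′ = coherent-AB a∈A b∈B
    coherent′ a∈ b∈ | inj₂ a∈B′ | inj₁ b∈A with _ , a∈B , refl ← ∈-map⁻ (shiftCol s) a∈B′ = coherent-BA a∈B b∈A
    coherent′ a∈ b∈ | inj₂ a∈B′ | inj₂ b∈B′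
      with _ , a∈B , refl ← ∈-map⁻ (shiftCol s) a∈B′ | _ , b∈B , refl ← ∈-map⁻ (shiftCol s) b∈B′ = coherent-BB a∈B b∈B

translate : ℕ → Point → Point
translate K p = px p + K , py p + K

translate-≺ : ∀ K {p q} → p ≺ q → translate K p ≺ translate K q
translate-≺ K (x< , y<) = +-monoˡ-< K x< , +-monoˡ-< K y<

translateL : ℕ → Labelled → Labelled
translateL K a = translate K (pt a) , col a

draws-translate : ∀ K {xs σ} → Draws xs σ → Draws (map (translateL K) xs) σ
draws-translate K {xs} d = record { length≡ = trans (length-map _ xs) (length≡ d) ; col< = col<′ ; coherent = coh }
  where
  col<′ : ∀ {a} → a ∈ map (translateL K) xs → col a < _
  col<′ a∈ with _ , a∈xs , refl ← ∈-map⁻ (translateL K) a∈ = col< d a∈xs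
  coh : ∀ {a b} → a ∈ map (translateL K) xs → b ∈ map (translateL K) xs → Coherent _ a b
  coh a∈ b∈ with _ , a∈xs , refl ← ∈-map⁻ (translateL K) a∈ | _ , b∈xs , refl ← ∈-map⁻ (translateL K) b∈ = record
    { x→col = λ h → x→col c (+-cancelʳ-< K _ _ h) ; col→x = λ h → +-monoˡ-< K (col→x c h)
    ; y→val = λ h → y→val c (+-cancelʳ-< K _ _ h) ; val→y = λ h → +-monoˡ-< K (val→y c h) }
    where c = coherent d a∈xs b∈xs

formsPerm-translate : ∀ K {ps σ} → FormsPerm ps σ → FormsPerm (map (translate K) ps) σ
formsPerm-translate K {ps} {σ} fp with xs , refl , d ← formsPerm⇒draws {ps} {σ} fp =
  subst (λ l → FormsPerm l σ) (trans (sym (map-∘ xs)) (map-∘ xs)) (draws⇒formsPerm (draws-translate K d))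

private
  ⊕₂-drawing : ∀ {σ ρ ps qs} → Bounded σ → FormsPerm ps σ → FormsPerm qs ρ → All (λ p → All (p ≺_) qs) ps →
    Σ (List Labelled) λ xs → Σ (List Labelled) λ ys → map pt xs ≡ ps × map pt ys ≡ qs × Draws (xs ++ ys) (σ ⊕₂ ρ)
  ⊕₂-drawing {σ} {ρ} {ps} {qs} bσ fpσ fpρ ps≺qs
    with xs , refl , dσ ← formsPerm⇒draws {ps} {σ} fpσ | ys , refl , dρ ← formsPerm⇒draws {qs} {ρ} fpρ =
    xs , map (shiftCol (length σ)) ys , refl , sym (map-∘ ys) ,
    draws-⊕₂ bσ dσ dρ (λ a∈ b∈ → All.lookup (All.lookup ps≺qs (∈-map⁺ pt a∈)) (∈-map⁺ pt b∈))

formsPerm-⊕₂ : ∀ {σ ρ ps qs} → Bounded σ → FormsPerm ps σ → FormsPerm qs ρ → All (λ p → All (p ≺_) qs) ps →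
  FormsPerm (ps ++ qs) (σ ⊕₂ ρ)
formsPerm-⊕₂ {σ} {ρ} bσ fpσ fpρ ps≺qs with xs , ys , refl , refl , d ← ⊕₂-drawing bσ fpσ fpρ ps≺qs =
  subst (λ l → FormsPerm l (σ ⊕₂ ρ)) (map-++ pt xs ys) (draws⇒formsPerm d)

formsPerm-⊕₂-swapped : ∀ {σ ρ ps qs} → Bounded σ → FormsPerm ps σ → FormsPerm qs ρ → All (λ p → All (p ≺_) qs) ps →
  FormsPerm (qs ++ ps) (σ ⊕₂ ρ)
formsPerm-⊕₂-swapped {σ} {ρ} bσ fpσ fpρ ps≺qs with xs , ys , refl , refl , d ← ⊕₂-drawing bσ fpσ fpρ ps≺qs =
  subst (λ l → FormsPerm l (σ ⊕₂ ρ)) (map-++ pt ys xs) (draws⇒formsPerm (draws-resp-↭ (++-comm xs ys) d))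

-- Pin sequences

realizes-++⁻ : ∀ {H w} ps qs → RealizesFrom H w (ps ++ qs) →
  Σ Word λ w₁ → Σ Word λ w₂ → w ≡ w₁ ++ w₂ × RealizesFrom H w₁ ps × RealizesFrom (ps ʳ++ H) w₂ qs
realizes-++⁻ {w = w}     []       qs r = [] , w , refl , tt , r
realizes-++⁻ {w = m ∷ w} (p ∷ ps) qs (pin , r) with w₁ , w₂ , refl , r₁ , r₂ ← realizes-++⁻ ps qs r =
  m ∷ w₁ , w₂ , refl , (pin , r₁) , r₂

realizes-++⁺ : ∀ {H} w₁ w₂ ps qs → RealizesFrom H w₁ ps → RealizesFrom (ps ʳ++ H) w₂ qs →
  RealizesFrom H (w₁ ++ w₂) (ps ++ qs)
realizes-++⁺ []       w₂ []       qs r₁         r₂ = r₂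
realizes-++⁺ (m ∷ w₁) w₂ (p ∷ ps) qs (pin , r₁) r₂ = pin , realizes-++⁺ w₁ w₂ ps qs r₁ r₂

realizes-cut : ∀ {H w} ps u qs → RealizesFrom H w (ps ++ u ∷ qs) →
  Σ Word λ w₁ → Σ Word λ w₂ → w ≡ w₁ ++ w₂ × RealizesFrom H w₁ (ps ++ u ∷ []) × RealizesFrom (u ∷ ps ʳ++ H) w₂ qs
realizes-cut {H} ps u qs r
  with w₁ , w₂ , eq , r₁ , r₂ ← realizes-++⁻ (ps ++ u ∷ []) qs (subst (RealizesFrom H _) (sym (++-assoc ps (u ∷ []) qs)) r) =
  w₁ , w₂ , eq , r₁ , subst (λ H′ → RealizesFrom H′ w₂ qs) (++-ʳ++ ps) r₂

OutsideBox : List Point → Point → Set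
OutsideBox H p = All (λ q → py q < py p) H ⊎ All (λ q → py p < py q) H
               ⊎ All (λ q → px q < px p) H ⊎ All (λ q → px p < px q) H

pin-outside : ∀ m {H p} → Pin m H p → OutsideBox H p
pin-outside n1 h = inj₁ (All.map proj₂ h)
pin-outside n2 h = inj₁ (All.map proj₂ h)
pin-outside n3 h = inj₂ (inj₁ (All.map proj₂ h))
pin-outside n4 h = inj₂ (inj₁ (All.map proj₂ h))
pin-outside U {_ ∷ _ ∷ _} (h , _) = inj₁ h
pin-outside D {_ ∷ _ ∷ _} (h , _) = inj₂ (inj₁ h)
pin-outside R {_ ∷ _ ∷ _} (h , _) = inj₂ (inj₂ (inj₁ h))
pin-outside L {_ ∷ _ ∷ _} (h , _) = inj₂ (inj₂ (inj₂ h))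

outside⇒fresh : ∀ {H p} → OutsideBox H p → All (_≢ p) H
outside⇒fresh (inj₁ h)                 = All.map (λ lt eq → <-irrefl (cong py eq) lt) h
outside⇒fresh (inj₂ (inj₁ h))          = All.map (λ lt eq → <-irrefl (cong py (sym eq)) lt) h
outside⇒fresh (inj₂ (inj₂ (inj₁ h)))   = All.map (λ lt eq → <-irrefl (cong px eq) lt) h
outside⇒fresh (inj₂ (inj₂ (inj₂ h)))   = All.map (λ lt eq → <-irrefl (cong px (sym eq)) lt) h

realizes-fresh : ∀ {H} w ps → RealizesFrom H w ps → All (λ p → All (_≢ p) H) ps
realizes-fresh []      []       _         = []
realizes-fresh (m ∷ w) (p ∷ ps) (pin , r) =
  outside⇒fresh (pin-outside m pin) ∷ All.map All.tail (realizes-fresh w ps r)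

realizes-distinct : ∀ {H} w ps → RealizesFrom H w ps → AllPairs _≢_ ps
realizes-distinct []      []       _         = []
realizes-distinct (m ∷ w) (p ∷ ps) (pin , r) =
  All.map All.head (realizes-fresh w ps r) ∷ realizes-distinct w ps r

realizes-distinctPoints : ∀ {H} w xs → RealizesFrom H w (map pt xs) → DistinctPoints xs
realizes-distinctPoints w xs r = AllPairs.map⁻ (realizes-distinct w (map pt xs) r)

pin-not-between : ∀ m {H p v v′} → Pin m H p → v ∈ H → p ≺ v → v′ ∈ H → v′ ≺ p → ⊥
pin-not-between m pin v∈ p≺v v′∈ v′≺p with pin-outside m pin
... | inj₁ h                 = <-asym (All.lookup h v∈) (proj₂ p≺v)
... | inj₂ (inj₁ h)          = <-asym (All.lookup h v′∈) (proj₂ v′≺p)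
... | inj₂ (inj₂ (inj₁ h))   = <-asym (All.lookup h v∈) (proj₁ p≺v)
... | inj₂ (inj₂ (inj₂ h))   = <-asym (All.lookup h v′∈) (proj₁ v′≺p)

-- Such a pin is a numeral 3, a D pin left of all of T, or an L pin below all of T.
pin-≺-spreads : ∀ m {a T p v} → Pin m (a ∷ T) p → v ∈ T → p ≺ v → All (p ≺_) T
pin-≺-spreads n1 (_ ∷ h) v∈ p≺v = ⊥-elim (<-asym (proj₁ (All.lookup h v∈)) (proj₁ p≺v))
pin-≺-spreads n2 (_ ∷ h) v∈ p≺v = ⊥-elim (<-asym (proj₂ (All.lookup h v∈)) (proj₂ p≺v))
pin-≺-spreads n3 (_ ∷ h) v∈ p≺v = h
pin-≺-spreads n4 (_ ∷ h) v∈ p≺v = ⊥-elim (<-asym (proj₁ (All.lookup h v∈)) (proj₁ p≺v))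
pin-≺-spreads U {T = _ ∷ _} ((_ ∷ h) , _) v∈ p≺v = ⊥-elim (<-asym (All.lookup h v∈) (proj₂ p≺v))
pin-≺-spreads R {T = _ ∷ _} ((_ ∷ h) , _) v∈ p≺v = ⊥-elim (<-asym (All.lookup h v∈) (proj₁ p≺v))
pin-≺-spreads D {T = _ ∷ _} ((_ ∷ h) , inj₁ (_ , s)) v∈ p≺v = All.zip (All.map⁻ s , h)
pin-≺-spreads D {T = _ ∷ _} ((_ ∷ h) , inj₂ (_ , s)) v∈ p≺v = ⊥-elim (<-asym (All.lookup (All.map⁻ s) v∈) (proj₁ p≺v))
pin-≺-spreads L {T = _ ∷ _} ((_ ∷ h) , inj₁ (_ , s)) v∈ p≺v = All.zip (h , All.map⁻ s)
pin-≺-spreads L {T = _ ∷ _} ((_ ∷ h) , inj₂ (_ , s)) v∈ p≺v = ⊥-elim (<-asym (All.lookup (All.map⁻ s) v∈) (proj₂ p≺v))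

pin-≻-spreads : ∀ m {a T p v} → Pin m (a ∷ T) p → v ∈ T → v ≺ p → All (_≺ p) T
pin-≻-spreads n1 (_ ∷ h) v∈ v≺p = h
pin-≻-spreads n2 (_ ∷ h) v∈ v≺p = ⊥-elim (<-asym (proj₁ (All.lookup h v∈)) (proj₁ v≺p))
pin-≻-spreads n3 (_ ∷ h) v∈ v≺p = ⊥-elim (<-asym (proj₁ (All.lookup h v∈)) (proj₁ v≺p))
pin-≻-spreads n4 (_ ∷ h) v∈ v≺p = ⊥-elim (<-asym (proj₂ (All.lookup h v∈)) (proj₂ v≺p))
pin-≻-spreads D {T = _ ∷ _} ((_ ∷ h) , _) v∈ v≺p = ⊥-elim (<-asym (All.lookup h v∈) (proj₂ v≺p))
pin-≻-spreads L {T = _ ∷ _} ((_ ∷ h) , _) v∈ v≺p = ⊥-elim (<-asym (All.lookup h v∈) (proj₁ v≺p))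
pin-≻-spreads U {T = _ ∷ _} ((_ ∷ h) , inj₂ (_ , s)) v∈ v≺p = All.zip (All.map⁻ s , h)
pin-≻-spreads U {T = _ ∷ _} ((_ ∷ h) , inj₁ (_ , s)) v∈ v≺p = ⊥-elim (<-asym (All.lookup (All.map⁻ s) v∈) (proj₁ v≺p))
pin-≻-spreads R {T = _ ∷ _} ((_ ∷ h) , inj₂ (_ , s)) v∈ v≺p = All.zip (h , All.map⁻ s)
pin-≻-spreads R {T = _ ∷ _} ((_ ∷ h) , inj₁ (_ , s)) v∈ v≺p = ⊥-elim (<-asym (All.lookup (All.map⁻ s) v∈) (proj₂ v≺p))

realizes-≺-spreads : ∀ {a T v} w qs → RealizesFrom (a ∷ T) w qs → v ∈ T → All (_≺ v) qs → All (λ q → All (q ≺_) T) qs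
realizes-≺-spreads []      []       _         _  _          = []
realizes-≺-spreads (m ∷ w) (q ∷ qs) (pin , r) v∈ (q≺v ∷ ≺v) =
  pin-≺-spreads m pin v∈ q≺v ∷ All.map All.tail (realizes-≺-spreads w qs r (there v∈) ≺v)

realizes-≻-spreads : ∀ {a T v} w qs → RealizesFrom (a ∷ T) w qs → v ∈ T → All (v ≺_) qs → All (λ q → All (_≺ q) T) qs
realizes-≻-spreads []      []       _         _  _          = []
realizes-≻-spreads (m ∷ w) (q ∷ qs) (pin , r) v∈ (v≺q ∷ v≺) =
  pin-≻-spreads m pin v∈ v≺q ∷ All.map All.tail (realizes-≻-spreads w qs r (there v∈) v≺)

first-pin-≺ : ∀ m {u T q v} → Pin m (u ∷ T) q → q ≺ u → v ∈ T → q ≺ v → Pin m (u ∷ []) q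
first-pin-≺ n1 (h ∷ _) _ _ _ = h ∷ []
first-pin-≺ n2 (h ∷ _) _ _ _ = h ∷ []
first-pin-≺ n3 (h ∷ _) _ _ _ = h ∷ []
first-pin-≺ n4 (h ∷ _) _ _ _ = h ∷ []
first-pin-≺ U {T = _ ∷ _} ((h ∷ _) , _) q≺u _ _ = ⊥-elim (<-asym h (proj₂ q≺u))
first-pin-≺ R {T = _ ∷ _} ((h ∷ _) , _) q≺u _ _ = ⊥-elim (<-asym h (proj₁ q≺u))
first-pin-≺ D {T = _ ∷ _} (_ , inj₁ (lt , _)) q≺u _  _   = ⊥-elim (<-asym lt (proj₁ q≺u))
first-pin-≺ D {T = _ ∷ _} (_ , inj₂ (_ , s))  _   v∈ q≺v = ⊥-elim (<-asym (All.lookup (All.map⁻ s) v∈) (proj₁ q≺v))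
first-pin-≺ L {T = _ ∷ _} (_ , inj₁ (lt , _)) q≺u _  _   = ⊥-elim (<-asym lt (proj₂ q≺u))
first-pin-≺ L {T = _ ∷ _} (_ , inj₂ (_ , s))  _   v∈ q≺v = ⊥-elim (<-asym (All.lookup (All.map⁻ s) v∈) (proj₂ q≺v))

first-pin-≻ : ∀ m {u T q v} → Pin m (u ∷ T) q → u ≺ q → v ∈ T → v ≺ q → Pin m (u ∷ []) q
first-pin-≻ n1 (h ∷ _) _ _ _ = h ∷ []
first-pin-≻ n2 (h ∷ _) _ _ _ = h ∷ []
first-pin-≻ n3 (h ∷ _) _ _ _ = h ∷ []
first-pin-≻ n4 (h ∷ _) _ _ _ = h ∷ []
first-pin-≻ D {T = _ ∷ _} ((h ∷ _) , _) u≺q _ _ = ⊥-elim (<-asym h (proj₂ u≺q))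
first-pin-≻ L {T = _ ∷ _} ((h ∷ _) , _) u≺q _ _ = ⊥-elim (<-asym h (proj₁ u≺q))
first-pin-≻ U {T = _ ∷ _} (_ , inj₂ (lt , _)) u≺q _  _   = ⊥-elim (<-asym lt (proj₁ u≺q))
first-pin-≻ U {T = _ ∷ _} (_ , inj₁ (_ , s))  _   v∈ v≺q = ⊥-elim (<-asym (All.lookup (All.map⁻ s) v∈) (proj₁ v≺q))
first-pin-≻ R {T = _ ∷ _} (_ , inj₂ (lt , _)) u≺q _  _   = ⊥-elim (<-asym lt (proj₂ u≺q))
first-pin-≻ R {T = _ ∷ _} (_ , inj₁ (_ , s))  _   v∈ v≺q = ⊥-elim (<-asym (All.lookup (All.map⁻ s) v∈) (proj₂ v≺q))

-- Whether a pin is valid depends on the older part of its history only through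
-- which of the four sides of the new point contain all of it.
record SidesInherited (H₁ H₂ : List Point) (p : Point) : Set where
  field
    left  : All (λ q → px p < px q) H₁ → All (λ q → px p < px q) H₂
    below : All (λ q → py p < py q) H₁ → All (λ q → py p < py q) H₂
    right : All (λ q → px q < px p) H₁ → All (λ q → px q < px p) H₂
    above : All (λ q → py q < py p) H₁ → All (λ q → py q < py p) H₂

open SidesInherited

separates-inherited : ∀ {c H₁ H₂} (f : Point → ℕ) {p} →
  (All (λ q → f p < f q) H₁ → All (λ q → f p < f q) H₂) → (All (λ q → f q < f p) H₁ → All (λ q → f q < f p) H₂) →
  Separates c (map f H₁) (f p) → Separates c (map f H₂) (f p)
separates-inherited f gt lt (inj₁ (c< , s)) = inj₁ (c< , All.map⁺ (gt (All.map⁻ s)))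
separates-inherited f gt lt (inj₂ (<c , s)) = inj₂ (<c , All.map⁺ (lt (All.map⁻ s)))

pin-inherited : ∀ m {a H₁ H₂ p} → H₂ ≢ [] → SidesInherited H₁ H₂ p → Pin m (a ∷ H₁) p → Pin m (a ∷ H₂) p
pin-inherited m  {H₂ = []}    H₂≢[] _  _        = ⊥-elim (H₂≢[] refl)
pin-inherited n1 {H₂ = _ ∷ _} _     sd (h ∷ hs) = h ∷ All.zip (right sd (All.map proj₁ hs) , above sd (All.map proj₂ hs))
pin-inherited n2 {H₂ = _ ∷ _} _     sd (h ∷ hs) = h ∷ All.zip (left sd (All.map proj₁ hs) , above sd (All.map proj₂ hs))
pin-inherited n3 {H₂ = _ ∷ _} _     sd (h ∷ hs) = h ∷ All.zip (left sd (All.map proj₁ hs) , below sd (All.map proj₂ hs))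
pin-inherited n4 {H₂ = _ ∷ _} _     sd (h ∷ hs) = h ∷ All.zip (right sd (All.map proj₁ hs) , below sd (All.map proj₂ hs))
pin-inherited U {H₁ = H₁@(_ ∷ _)} {H₂@(_ ∷ _)} {p} _ sd ((h ∷ hs) , s) =
  (h ∷ above sd hs) , separates-inherited {H₁ = H₁} {H₂} px {p} (left sd) (right sd) s
pin-inherited D {H₁ = H₁@(_ ∷ _)} {H₂@(_ ∷ _)} {p} _ sd ((h ∷ hs) , s) =
  (h ∷ below sd hs) , separates-inherited {H₁ = H₁} {H₂} px {p} (left sd) (right sd) s
pin-inherited R {H₁ = H₁@(_ ∷ _)} {H₂@(_ ∷ _)} {p} _ sd ((h ∷ hs) , s) =
  (h ∷ right sd hs) , separates-inherited {H₁ = H₁} {H₂} py {p} (below sd) (above sd) s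
pin-inherited L {H₁ = H₁@(_ ∷ _)} {H₂@(_ ∷ _)} {p} _ sd ((h ∷ hs) , s) =
  (h ∷ left sd hs) , separates-inherited {H₁ = H₁} {H₂} py {p} (below sd) (above sd) s

++-∷-≢-[] : ∀ {A : Set} (X : List A) {u T} → X ++ u ∷ T ≢ []
++-∷-≢-[] X eq with () ← ++-conicalʳ X _ eq

ʳ++-∷-≢-[] : ∀ {A : Set} (xs : List A) {y ys} → xs ʳ++ y ∷ ys ≢ []
ʳ++-∷-≢-[] xs eq = ++-∷-≢-[] (reverse xs) (trans (sym (ʳ++-defn xs)) eq)

realizes-forget : ∀ {a} X u T w qs → RealizesFrom (a ∷ X ++ u ∷ T) w qs → RealizesFrom (a ∷ X ++ u ∷ []) w qs
realizes-forget X u T []      []       _         = tt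
realizes-forget X u T (m ∷ w) (q ∷ qs) (pin , r) =
  pin-inherited m (++-∷-≢-[] X) (record { left = prefix ; below = prefix ; right = prefix ; above = prefix }) pin ,
  realizes-forget (_ ∷ X) u T w qs r
  where
  prefix : ∀ {P : Point → Set} → All P (X ++ u ∷ T) → All P (X ++ u ∷ [])
  prefix h = All.++⁺ (All.++⁻ˡ X h) (All.head (All.++⁻ʳ X h) ∷ [])

realizes-restrict-≺ : ∀ {u T v} w qs → RealizesFrom (u ∷ T) w qs → All (_≺ u) qs → v ∈ T → All (_≺ v) qs →
  Realizes u w qs
realizes-restrict-≺ []      []       _         _          _  _          = tt
realizes-restrict-≺ {u} {T} (m ∷ w) (q ∷ qs) (pin , r) (q≺u ∷ _) v∈ (q≺v ∷ _) =
  first-pin-≺ m pin q≺u v∈ q≺v , realizes-forget [] u T w qs r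

realizes-restrict-≻ : ∀ {u T v} w qs → RealizesFrom (u ∷ T) w qs → All (u ≺_) qs → v ∈ T → All (v ≺_) qs →
  Realizes u w qs
realizes-restrict-≻ []      []       _         _          _  _          = tt
realizes-restrict-≻ {u} {T} (m ∷ w) (q ∷ qs) (pin , r) (u≺q ∷ _) v∈ (v≺q ∷ _) =
  first-pin-≻ m pin u≺q v∈ v≺q , realizes-forget [] u T w qs r

module _ {P : Point → Set} (X : List Point) {o : Point} where
  All-replace-last : ∀ {Q} → All P (X ++ o ∷ []) → All P Q → All P (X ++ Q)
  All-replace-last h hQ = All.++⁺ (All.++⁻ˡ X h) hQ

  All-last : All P (X ++ o ∷ []) → P o
  All-last h = All.head (All.++⁻ʳ X h)

realizes-widen-≺ : ∀ {o Q} w qs → Q ≢ [] → Realizes o w qs → All (_≺ o) qs → All (λ q → All (q ≺_) Q) qs →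
  RealizesFrom Q w qs
realizes-widen-≺ {o} {Q} []      []       _     _         _          _          = tt
realizes-widen-≺ {o} {Q} (m ∷ w) (q ∷ qs) Q≢[] (pin , r) (q≺o ∷ ≺o) (q≺Q ∷ ≺Q) = first m pin , later [] w qs r ≺o ≺Q
  where
  first : ∀ m → Pin m (o ∷ []) q → Pin m Q q
  first n1 (h ∷ []) = ⊥-elim (<-asym (proj₁ h) (proj₁ q≺o))
  first n2 (h ∷ []) = ⊥-elim (<-asym (proj₂ h) (proj₂ q≺o))
  first n3 (h ∷ []) = q≺Q
  first n4 (h ∷ []) = ⊥-elim (<-asym (proj₁ h) (proj₁ q≺o))
  later : ∀ {a} X w qs → RealizesFrom (a ∷ X ++ o ∷ []) w qs → All (_≺ o) qs → All (λ q → All (q ≺_) Q) qs →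
    RealizesFrom (a ∷ X ++ Q) w qs
  later X []      []       _         _           _           = tt
  later X (m ∷ w) (p ∷ ps) (pin , r) (p≺o ∷ ≺o′) (p≺Q ∷ ≺Q′) =
    pin-inherited m (λ eq → Q≢[] (++-conicalʳ X Q eq)) sides pin , later (_ ∷ X) w ps r ≺o′ ≺Q′
    where
    sides : SidesInherited (X ++ o ∷ []) (X ++ Q) p
    sides = record
      { left  = λ h → All-replace-last X h (All.map proj₁ p≺Q)
      ; below = λ h → All-replace-last X h (All.map proj₂ p≺Q)
      ; right = λ h → ⊥-elim (<-asym (All-last X h) (proj₁ p≺o))
      ; above = λ h → ⊥-elim (<-asym (All-last X h) (proj₂ p≺o))
      }

realizes-widen-≻ : ∀ {o Q} w qs → Q ≢ [] → Realizes o w qs → All (o ≺_) qs → All (λ q → All (_≺ q) Q) qs →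
  RealizesFrom Q w qs
realizes-widen-≻ {o} {Q} []      []       _     _         _          _          = tt
realizes-widen-≻ {o} {Q} (m ∷ w) (q ∷ qs) Q≢[] (pin , r) (o≺q ∷ o≺) (Q≺q ∷ Q≺) = first m pin , later [] w qs r o≺ Q≺
  where
  first : ∀ m → Pin m (o ∷ []) q → Pin m Q q
  first n1 (h ∷ []) = Q≺q
  first n2 (h ∷ []) = ⊥-elim (<-asym (proj₁ h) (proj₁ o≺q))
  first n3 (h ∷ []) = ⊥-elim (<-asym (proj₁ h) (proj₁ o≺q))
  first n4 (h ∷ []) = ⊥-elim (<-asym (proj₂ h) (proj₂ o≺q))
  later : ∀ {a} X w qs → RealizesFrom (a ∷ X ++ o ∷ []) w qs → All (o ≺_) qs → All (λ q → All (_≺ q) Q) qs →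
    RealizesFrom (a ∷ X ++ Q) w qs
  later X []      []       _         _           _           = tt
  later X (m ∷ w) (p ∷ ps) (pin , r) (o≺p ∷ o≺′) (Q≺p ∷ Q≺′) =
    pin-inherited m (λ eq → Q≢[] (++-conicalʳ X Q eq)) sides pin , later (_ ∷ X) w ps r o≺′ Q≺′
    where
    sides : SidesInherited (X ++ o ∷ []) (X ++ Q) p
    sides = record
      { left  = λ h → ⊥-elim (<-asym (All-last X h) (proj₁ o≺p))
      ; below = λ h → ⊥-elim (<-asym (All-last X h) (proj₂ o≺p))
      ; right = λ h → All-replace-last X h (All.map proj₁ Q≺p)
      ; above = λ h → All-replace-last X h (All.map proj₂ Q≺p)
      }

separates-translate : ∀ K (f : Point → ℕ) {a c} E → (∀ q → f (translate K q) ≡ f q + K) →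
  Separates a (map f E) c → Separates (a + K) (map f (map (translate K) E)) (c + K)
separates-translate K f E f+K s = subst (λ l → Separates _ l _) (trans (map-cong (λ q → sym (f+K q)) E) (map-∘ E)) (shift s)
  where
  shift : ∀ {a c} → Separates a (map f E) c → Separates (a + K) (map (λ q → f q + K) E) (c + K)
  shift (inj₁ (a<c , s)) = inj₁ (+-monoˡ-< K a<c , All.map⁺ (All.map (+-monoˡ-< K) (All.map⁻ s)))
  shift (inj₂ (c<a , s)) = inj₂ (+-monoˡ-< K c<a , All.map⁺ (All.map (+-monoˡ-< K) (All.map⁻ s)))

pin-translate : ∀ K m {H p} → Pin m H p → Pin m (map (translate K) H) (translate K p)
pin-translate K n1 h = All.map⁺ (All.map (λ (x< , y<) → +-monoˡ-< K x< , +-monoˡ-< K y<) h)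
pin-translate K n2 h = All.map⁺ (All.map (λ (x< , y<) → +-monoˡ-< K x< , +-monoˡ-< K y<) h)
pin-translate K n3 h = All.map⁺ (All.map (λ (x< , y<) → +-monoˡ-< K x< , +-monoˡ-< K y<) h)
pin-translate K n4 h = All.map⁺ (All.map (λ (x< , y<) → +-monoˡ-< K x< , +-monoˡ-< K y<) h)
pin-translate K U {_ ∷ E@(_ ∷ _)} (h , s) = All.map⁺ (All.map (+-monoˡ-< K) h) , separates-translate K px E (λ _ → refl) s
pin-translate K D {_ ∷ E@(_ ∷ _)} (h , s) = All.map⁺ (All.map (+-monoˡ-< K) h) , separates-translate K px E (λ _ → refl) s
pin-translate K R {_ ∷ E@(_ ∷ _)} (h , s) = All.map⁺ (All.map (+-monoˡ-< K) h) , separates-translate K py E (λ _ → refl) s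
pin-translate K L {_ ∷ E@(_ ∷ _)} (h , s) = All.map⁺ (All.map (+-monoˡ-< K) h) , separates-translate K py E (λ _ → refl) s

realizes-translate : ∀ K {H} w ps → RealizesFrom H w ps → RealizesFrom (map (translate K) H) w (map (translate K) ps)
realizes-translate K []      []       _         = tt
realizes-translate K (m ∷ w) (p ∷ ps) (pin , r) = pin-translate K m pin , realizes-translate K w ps r

-- Peeling off an outer block

-- Points of σ among i would lie above-right of the run and split σ as a sum.
lower-run⇒prefix-high : ∀ {σ ρ i u z zs} → ⊕-Indecomposable σ →
  Draws (i ++ u ∷ z ∷ zs) (σ ⊕₂ ρ) → DistinctPoints (i ++ u ∷ z ∷ zs) →
  ¬ col u < length σ → All (λ a → col a < length σ) (z ∷ zs) → (∀ {a b} → a ∈ z ∷ zs → b ∈ i → pt a ≺ pt b) →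
  All (λ a → length σ ≤ col a) i
lower-run⇒prefix-high {σ} {ρ} {i} {u} {z} {zs} ind d dp u≮ run-low run≺i with All.all? (λ a → length σ ≤? col a) i
... | yes i-high = i-high
... | no i-not-high with e , e∈i , e≰ ← find (¬All⇒Any¬ (λ a → length σ ≤? col a) i i-not-high) =
  ⊥-elim (≺-partition-impossible ind (subst (λ l → Draws l σ) Lo≡ draws-Lo)
           (AllPairs.filter⁺ low? (proj₁ parts)) (AllPairs.drop⁺ 1 (proj₂ parts))
           (∈-filter⁺ low? e∈i (≰⇒> e≰)) (here refl) run≺E)
  where
  open ⊕₂-Split σ ρ (bounded ind) d dp
  parts : DistinctPoints i × DistinctPoints (u ∷ z ∷ zs)
  parts = AllPairs-++⁻ i dp
  E : List Labelled
  E = filter low? i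
  Lo≡ : Lo ≡ E ++ z ∷ zs
  Lo≡ = trans (filter-++ low? i (u ∷ z ∷ zs)) (cong (E ++_) (trans (filter-reject low? u≮) (filter-all low? run-low)))
  run≺E : ∀ {a b} → a ∈ z ∷ zs → b ∈ E → pt a ≺ pt b
  run≺E a∈ b∈ = run≺i a∈ (proj₁ (∈-filter⁻ low? {xs = i} b∈))

upper-run⇒prefix-low : ∀ {σ ρ i u z zs} → Bounded σ → ⊕-Indecomposable ρ →
  Draws (i ++ u ∷ z ∷ zs) (σ ⊕₂ ρ) → DistinctPoints (i ++ u ∷ z ∷ zs) →
  ¬ length σ ≤ col u → All (λ a → length σ ≤ col a) (z ∷ zs) → (∀ {a b} → a ∈ z ∷ zs → b ∈ i → pt b ≺ pt a) →
  All (λ a → col a < length σ) i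
upper-run⇒prefix-low {σ} {ρ} {i} {u} {z} {zs} bσ ind d dp u≱ run-high i≺run with All.all? (λ a → col a <? length σ) i
... | yes i-low = i-low
... | no i-not-low with e , e∈i , e≮ ← find (¬All⇒Any¬ (λ a → col a <? length σ) i i-not-low) =
  ⊥-elim (≺-partition-impossible ind (draws-resp-↭ (++-comm (map (unshiftCol s) E) _) draws-Hi′)
           (AllPairs.map⁺ (AllPairs.drop⁺ 1 (proj₂ parts))) (AllPairs.map⁺ (AllPairs.filter⁺ high? (proj₁ parts)))
           (here refl) (∈-map⁺ (unshiftCol s) (∈-filter⁺ high? e∈i (≮⇒≥ e≮))) E≺run)
  where
  open ⊕₂-Split σ ρ bσ d dp
  parts : DistinctPoints i × DistinctPoints (u ∷ z ∷ zs)
  parts = AllPairs-++⁻ i dp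
  E : List Labelled
  E = filter high? i
  Hi≡ : Hi ≡ E ++ z ∷ zs
  Hi≡ = trans (filter-++ high? i (u ∷ z ∷ zs)) (cong (E ++_) (trans (filter-reject high? u≱) (filter-all high? run-high)))
  draws-Hi′ : Draws (map (unshiftCol s) E ++ map (unshiftCol s) (z ∷ zs)) ρ
  draws-Hi′ = subst (λ l → Draws l ρ) (trans (cong (map (unshiftCol s)) Hi≡) (map-++ (unshiftCol s) E (z ∷ zs))) draws-Hi
  E≺run : ∀ {a b} → a ∈ map (unshiftCol s) E → b ∈ map (unshiftCol s) (z ∷ zs) → pt a ≺ pt b
  E≺run a∈ b∈ with _ , a∈E , refl ← ∈-map⁻ (unshiftCol s) a∈ | _ , b∈run , refl ← ∈-map⁻ (unshiftCol s) b∈ =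
    i≺run b∈run (proj₁ (∈-filter⁻ high? {xs = i} a∈E))

peel-lower : ∀ {σ ρ p0 w} i u z zs → ⊕-Indecomposable σ → 2 ≤ length ρ →
  Realizes p0 w (map pt (i ++ u ∷ z ∷ zs)) → Draws (i ++ u ∷ z ∷ zs) (σ ⊕₂ ρ) →
  ¬ col u < length σ → All (λ a → col a < length σ) (z ∷ zs) → (P ρ · Pq n1 σ) w
peel-lower {σ} {ρ} {p0} {w} i u z zs ind 2≤ρ r d u≮ run-low
  with w₁ , w₂ , refl , r₁ , r₂ ←
         realizes-cut (map pt i) (pt u) (map pt (z ∷ zs)) (subst (Realizes p0 w) (map-++ pt i (u ∷ z ∷ zs)) r)
  = w₁ , w₂ , refl , (p0 , map pt (i ++ u ∷ []) , r-prefix , fp-ρ) , (pt u , map pt (z ∷ zs) , r-run , fp-σ , run≺u)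
  where
  run xs : List Labelled
  run = z ∷ zs
  xs = i ++ u ∷ run
  dp : DistinctPoints xs
  dp = realizes-distinctPoints _ xs r
  open ⊕₂-Split σ ρ (bounded ind) d dp
  v : Σ Labelled λ v → v ∈ i × High v
  v = high-before {i} {u} {run} refl run-low 2≤ρ
  T₀ : List Point
  T₀ = map pt i ʳ++ (p0 ∷ [])
  in-T₀ : ∀ {b} → b ∈ i → pt b ∈ T₀
  in-T₀ b∈ = reverseAcc⁺ (p0 ∷ []) (map pt i) (inj₂ (∈-map⁺ pt b∈))
  run≺ : ∀ {b} → b ∈ xs → High b → All (_≺ pt b) (map pt run)
  run≺ b∈ b-high = All.map⁺ (All.tabulate (λ a∈ → low≺high (∈-++⁺ʳ i (there a∈)) b∈ (All.lookup run-low a∈) b-high))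
  run≺u : All (_≺ pt u) (map pt run)
  run≺u = run≺ (∈-++⁺ʳ i (here refl)) (≮⇒≥ u≮)
  run≺v : All (_≺ pt (proj₁ v)) (map pt run)
  run≺v = run≺ (∈-++⁺ˡ (proj₁ (proj₂ v))) (proj₂ (proj₂ v))
  run≺T₀ : All (λ q → All (q ≺_) T₀) (map pt run)
  run≺T₀ = realizes-≺-spreads w₂ (map pt run) r₂ (in-T₀ (proj₁ (proj₂ v))) run≺v
  prefix-high : All High (i ++ u ∷ [])
  prefix-high = All.++⁺ (lower-run⇒prefix-high ind d dp u≮ run-low
                          (λ a∈ b∈ → All.lookup (All.lookup run≺T₀ (∈-map⁺ pt a∈)) (in-T₀ b∈)))
                        (≮⇒≥ u≮ ∷ [])
  xs≡ : xs ≡ (i ++ u ∷ []) ++ run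
  xs≡ = sym (++-assoc i (u ∷ []) run)
  fp-ρ : FormsPerm (map pt (i ++ u ∷ [])) ρ
  fp-ρ = subst (λ l → FormsPerm l ρ)
    (trans (sym (map-∘ Hi)) (cong (map pt) (trans (cong (filter high?) xs≡) (filter-++-keepˡ high? prefix-high (All.map <⇒≱ run-low)))))
    (draws⇒formsPerm draws-Hi)
  fp-σ : FormsPerm (map pt run) σ
  fp-σ = subst (λ l → FormsPerm (map pt l) σ)
    (trans (cong (filter low?) xs≡) (filter-++-keepʳ low? (All.map (λ s≤ <s → <⇒≱ <s s≤) prefix-high) run-low))
    (draws⇒formsPerm draws-Lo)
  r-prefix : Realizes p0 w₁ (map pt (i ++ u ∷ []))
  r-prefix = subst (Realizes p0 w₁) (sym (map-++ pt i (u ∷ []))) r₁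
  r-run : Realizes (pt u) w₂ (map pt run)
  r-run = realizes-restrict-≺ w₂ (map pt run) r₂ run≺u (in-T₀ (proj₁ (proj₂ v))) run≺v

peel-upper : ∀ {σ ρ p0 w} i u z zs → Bounded σ → ⊕-Indecomposable ρ → 2 ≤ length σ →
  Realizes p0 w (map pt (i ++ u ∷ z ∷ zs)) → Draws (i ++ u ∷ z ∷ zs) (σ ⊕₂ ρ) →
  ¬ length σ ≤ col u → All (λ a → length σ ≤ col a) (z ∷ zs) → (P σ · Pq n3 ρ) w
peel-upper {σ} {ρ} {p0} {w} i u z zs bσ ind 2≤σ r d u≱ run-high
  with w₁ , w₂ , refl , r₁ , r₂ ←
         realizes-cut (map pt i) (pt u) (map pt (z ∷ zs)) (subst (Realizes p0 w) (map-++ pt i (u ∷ z ∷ zs)) r)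
  = w₁ , w₂ , refl , (p0 , map pt (i ++ u ∷ []) , r-prefix , fp-σ) , (pt u , map pt (z ∷ zs) , r-run , fp-ρ , u≺run)
  where
  run xs : List Labelled
  run = z ∷ zs
  xs = i ++ u ∷ run
  dp : DistinctPoints xs
  dp = realizes-distinctPoints _ xs r
  open ⊕₂-Split σ ρ bσ d dp
  v : Σ Labelled λ v → v ∈ i × Low v
  v = low-before {i} {u} {run} refl run-high 2≤σ
  T₀ : List Point
  T₀ = map pt i ʳ++ (p0 ∷ [])
  in-T₀ : ∀ {b} → b ∈ i → pt b ∈ T₀
  in-T₀ b∈ = reverseAcc⁺ (p0 ∷ []) (map pt i) (inj₂ (∈-map⁺ pt b∈))
  ≺run : ∀ {b} → b ∈ xs → Low b → All (pt b ≺_) (map pt run)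
  ≺run b∈ b-low = All.map⁺ (All.tabulate (λ a∈ → low≺high b∈ (∈-++⁺ʳ i (there a∈)) b-low (All.lookup run-high a∈)))
  u≺run : All (pt u ≺_) (map pt run)
  u≺run = ≺run (∈-++⁺ʳ i (here refl)) (≰⇒> u≱)
  v≺run : All (pt (proj₁ v) ≺_) (map pt run)
  v≺run = ≺run (∈-++⁺ˡ (proj₁ (proj₂ v))) (proj₂ (proj₂ v))
  T₀≺run : All (λ q → All (_≺ q) T₀) (map pt run)
  T₀≺run = realizes-≻-spreads w₂ (map pt run) r₂ (in-T₀ (proj₁ (proj₂ v))) v≺run
  prefix-low : All Low (i ++ u ∷ [])
  prefix-low = All.++⁺ (upper-run⇒prefix-low bσ ind d dp u≱ run-high
                         (λ a∈ b∈ → All.lookup (All.lookup T₀≺run (∈-map⁺ pt a∈)) (in-T₀ b∈)))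
                       (≰⇒> u≱ ∷ [])
  xs≡ : xs ≡ (i ++ u ∷ []) ++ run
  xs≡ = sym (++-assoc i (u ∷ []) run)
  fp-σ : FormsPerm (map pt (i ++ u ∷ [])) σ
  fp-σ = subst (λ l → FormsPerm (map pt l) σ)
    (trans (cong (filter low?) xs≡) (filter-++-keepˡ low? prefix-low (All.map (λ s≤ <s → <⇒≱ <s s≤) run-high)))
    (draws⇒formsPerm draws-Lo)
  fp-ρ : FormsPerm (map pt run) ρ
  fp-ρ = subst (λ l → FormsPerm l ρ)
    (trans (sym (map-∘ Hi)) (cong (map pt) (trans (cong (filter high?) xs≡) (filter-++-keepʳ high? (All.map <⇒≱ prefix-low) run-high))))
    (draws⇒formsPerm draws-Hi)
  r-prefix : Realizes p0 w₁ (map pt (i ++ u ∷ []))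
  r-prefix = subst (Realizes p0 w₁) (sym (map-++ pt i (u ∷ []))) r₁
  r-run : Realizes (pt u) w₂ (map pt run)
  r-run = realizes-restrict-≻ w₂ (map pt run) r₂ u≺run (in-T₀ (proj₁ (proj₂ v))) v≺run

-- A point of a middle block lies above-right of the first block and below-left of
-- the last one, hence inside the bounding box of the earlier points.
last-pin-not-in-middle : ∀ {σ₁ ρ₁ σ₂ ρ₂ p0 w} i u → Bounded σ₁ → Bounded σ₂ → 1 ≤ length σ₁ → 1 ≤ length ρ₂ →
  Realizes p0 w (map pt (i ++ u ∷ [])) → Draws (i ++ u ∷ []) (σ₁ ⊕₂ ρ₁) → Draws (i ++ u ∷ []) (σ₂ ⊕₂ ρ₂) →
  ¬ col u < length σ₁ → ¬ length σ₂ ≤ col u → ⊥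
last-pin-not-in-middle {σ₁} {ρ₁} {σ₂} {ρ₂} {p0} {w} i u bσ₁ bσ₂ 1≤σ₁ 1≤ρ₂ r d₁ d₂ u≮ u≱
  with realizes-++⁻ (map pt i) (pt u ∷ []) (subst (Realizes p0 w) (map-++ pt i (u ∷ [])) r)
... | _ , m ∷ [] , _ , _ , (pin , _) = between (V₁.∃-low 1≤σ₁) (V₂.∃-high 1≤ρ₂)
  where
  dp : DistinctPoints (i ++ u ∷ [])
  dp = realizes-distinctPoints _ (i ++ u ∷ []) r
  module V₁ = ⊕₂-Split σ₁ ρ₁ bσ₁ d₁ dp
  module V₂ = ⊕₂-Split σ₂ ρ₂ bσ₂ d₂ dp
  u∈ : u ∈ i ++ u ∷ []
  u∈ = ∈-++⁺ʳ i (here refl)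
  in-history : ∀ {a} → a ∈ i ++ u ∷ [] → a ≢ u → pt a ∈ map pt i ʳ++ (p0 ∷ [])
  in-history a∈ a≢u with ∈-++⁻ i a∈
  ... | inj₁ a∈i        = reverseAcc⁺ (p0 ∷ []) (map pt i) (inj₂ (∈-map⁺ pt a∈i))
  ... | inj₂ (here a≡u) = ⊥-elim (a≢u a≡u)
  between : Σ Labelled (λ b → b ∈ i ++ u ∷ [] × V₁.Low b) → Σ Labelled (λ c → c ∈ i ++ u ∷ [] × V₂.High c) → ⊥
  between (b , b∈ , b-low) (c , c∈ , c-high) =
    pin-not-between m pin (in-history c∈ (λ { refl → u≱ c-high })) (V₂.low≺high u∈ c∈ (≰⇒> u≱) c-high)
                          (in-history b∈ (λ { refl → u≮ b-low })) (V₁.low≺high b∈ u∈ b-low (≮⇒≥ u≮))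

peel-outer : ∀ {σ₁ ρ₁ σ₂ ρ₂ w} → σ₁ ⊕₂ ρ₁ ≡ σ₂ ⊕₂ ρ₂ →
  ⊕-Indecomposable σ₁ → ⊕-Indecomposable ρ₂ → Bounded σ₂ → 2 ≤ length ρ₁ → 2 ≤ length σ₂ →
  P (σ₁ ⊕₂ ρ₁) w → (P ρ₁ · Pq n1 σ₁) w ⊎ (P σ₂ · Pq n3 ρ₂) w
peel-outer {σ₁} {ρ₁} {σ₂} {ρ₂} {w} eq ind₁ ind₂ bσ₂ 2≤ρ₁ 2≤σ₂ (p0 , ps , r , fp)
  with xs , refl , d₁ ← formsPerm⇒draws {ps} fp =
  cases (all-or-last-failure V₁.low? xs) (all-or-last-failure V₂.high? xs)
  where
  d₂ : Draws xs (σ₂ ⊕₂ ρ₂)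
  d₂ = subst (Draws xs) eq d₁
  dp : DistinctPoints xs
  dp = realizes-distinctPoints _ xs r
  module V₁ = ⊕₂-Split σ₁ ρ₁ (bounded ind₁) d₁ dp
  module V₂ = ⊕₂-Split σ₂ ρ₂ bσ₂ d₂ dp
  cases : All V₁.Low xs ⊎ LastFailure V₁.Low xs → All V₂.High xs ⊎ LastFailure V₂.High xs →
    (P ρ₁ · Pq n1 σ₁) w ⊎ (P σ₂ · Pq n3 ρ₂) w
  cases (inj₁ all-low) _ with _ , a∈ , a-high ← V₁.∃-high (≤-trans (n≤1+n 1) 2≤ρ₁) =
    ⊥-elim (<⇒≱ (All.lookup all-low a∈) a-high)
  cases (inj₂ (lastFailure i u (z ∷ zs) refl u≮ run-low)) _ = inj₁ (peel-lower i u z zs ind₁ 2≤ρ₁ r d₁ u≮ run-low)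
  cases (inj₂ (lastFailure _ _ [] _ _ _)) (inj₁ all-high) with _ , a∈ , a-low ← V₂.∃-low (≤-trans (n≤1+n 1) 2≤σ₂) =
    ⊥-elim (<⇒≱ a-low (All.lookup all-high a∈))
  cases (inj₂ (lastFailure _ _ [] _ _ _)) (inj₂ (lastFailure i u (z ∷ zs) refl u≱ run-high)) =
    inj₂ (peel-upper i u z zs bσ₂ ind₂ 2≤σ₂ r d₂ u≱ run-high)
  cases (inj₂ (lastFailure i u [] refl u≮ _)) (inj₂ (lastFailure i′ u′ [] xs≡ u′≱ _))
    with refl ← ∷ʳ-injectiveʳ i i′ xs≡ =
    ⊥-elim (last-pin-not-in-middle i u (bounded ind₁) bσ₂ (nonempty ind₁) (nonempty ind₂) r d₁ d₂ u≮ u′≱)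

Sh-∷ʳˡ : ∀ As Bs {y v} {A : Lang} → Sh As Bs y → A v → Sh (As ++ A ∷ []) Bs (y ++ v)
Sh-∷ʳˡ []       []       {v = v} refl                              Av =
  v , [] , sym (++-identityʳ v) , Av , refl
Sh-∷ʳˡ (_ ∷ As) []       {v = v} (a , w , refl , Aa , sh)          Av =
  a , w ++ v , ++-assoc a w v , Aa , Sh-∷ʳˡ As [] sh Av
Sh-∷ʳˡ []       (_ ∷ Bs) {v = v} (b , w , refl , Bb , sh)          Av =
  inj₂ (b , w ++ v , ++-assoc b w v , Bb , Sh-∷ʳˡ [] Bs sh Av)
Sh-∷ʳˡ (_ ∷ As) (B ∷ Bs) {v = v} (inj₁ (a , w , refl , Aa , sh))  Av =
  inj₁ (a , w ++ v , ++-assoc a w v , Aa , Sh-∷ʳˡ As (B ∷ Bs) sh Av)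
Sh-∷ʳˡ (A ∷ As) (_ ∷ Bs) {v = v} (inj₂ (b , w , refl , Bb , sh))  Av =
  inj₂ (b , w ++ v , ++-assoc b w v , Bb , Sh-∷ʳˡ (A ∷ As) Bs sh Av)

Sh-∷ʳʳ : ∀ As Bs {y v} {B : Lang} → Sh As Bs y → B v → Sh As (Bs ++ B ∷ []) (y ++ v)
Sh-∷ʳʳ []       []       {v = v} refl                              Bv =
  v , [] , sym (++-identityʳ v) , Bv , refl
Sh-∷ʳʳ (_ ∷ As) []       {v = v} (a , w , refl , Aa , sh)          Bv =
  inj₁ (a , w ++ v , ++-assoc a w v , Aa , Sh-∷ʳʳ As [] sh Bv)
Sh-∷ʳʳ []       (_ ∷ Bs) {v = v} (b , w , refl , Bb , sh)          Bv =
  b , w ++ v , ++-assoc b w v , Bb , Sh-∷ʳʳ [] Bs sh Bv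
Sh-∷ʳʳ (_ ∷ As) (B ∷ Bs) {v = v} (inj₁ (a , w , refl , Aa , sh))  Bv =
  inj₁ (a , w ++ v , ++-assoc a w v , Aa , Sh-∷ʳʳ As (B ∷ Bs) sh Bv)
Sh-∷ʳʳ (A ∷ As) (_ ∷ Bs) {v = v} (inj₂ (b , w , refl , Bb , sh))  Bv =
  inj₂ (b , w ++ v , ++-assoc b w v , Bb , Sh-∷ʳʳ (A ∷ As) Bs sh Bv)

·-mapˡ : ∀ {X X′ Y : Lang} → (∀ {w} → X w → X′ w) → ∀ {w} → (X · Y) w → (X′ · Y) w
·-mapˡ f (x , y , eq , Xx , Yy) = x , y , eq , f Xx , Yy

ShuffleForm : List (List ℕ) → Word → Set
ShuffleForm ξs w = Σ (List (List ℕ)) λ as → Σ (List ℕ) λ a → Σ (List ℕ) λ b → Σ (List (List ℕ)) λ bs →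
  ξs ≡ as ++ a ∷ b ∷ bs × (P (⊕ (a ∷ b ∷ [])) · Sh (map (Pq n1) (reverse as)) (map (Pq n3) bs)) w

shuffleForm-∷ : ∀ {ξ ρs w} → (ShuffleForm ρs · Pq n1 ξ) w → ShuffleForm (ξ ∷ ρs) w
shuffleForm-∷ {ξ} (_ , v , refl , (as , a , b , bs , refl , x , y , refl , Px , sh) , Pq-v) =
  ξ ∷ as , a , b , bs , refl , x , y ++ v , ++-assoc x y v , Px ,
  subst (λ As → Sh As (map (Pq n3) bs) (y ++ v)) (sym lowers≡) (Sh-∷ʳˡ _ _ sh Pq-v)
  where
  lowers≡ : map (Pq n1) (reverse (ξ ∷ as)) ≡ map (Pq n1) (reverse as) ++ Pq n1 ξ ∷ []
  lowers≡ = trans (cong (map (Pq n1)) (unfold-reverse ξ as)) (map-++ (Pq n1) (reverse as) (ξ ∷ []))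

shuffleForm-∷ʳ : ∀ {σs ξ w} → (ShuffleForm σs · Pq n3 ξ) w → ShuffleForm (σs ++ ξ ∷ []) w
shuffleForm-∷ʳ {ξ = ξ} (_ , v , refl , (as , a , b , bs , refl , x , y , refl , Px , sh) , Pq-v) =
  as , a , b , bs ++ ξ ∷ [] , ++-assoc as (a ∷ b ∷ bs) (ξ ∷ []) , x , y ++ v , ++-assoc x y v , Px ,
  subst (λ Bs → Sh (map (Pq n1) (reverse as)) Bs (y ++ v)) (sym (map-++ (Pq n3) bs (ξ ∷ []))) (Sh-∷ʳʳ _ _ sh Pq-v)

P⇒shuffleForm : ∀ n ξs → length ξs ≤ n → All ⊕-Indecomposable ξs → 2 ≤ length ξs →
  ∀ {w} → P (⊕ ξs) w → ShuffleForm ξs w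
P⇒shuffleForm n ξs len inds 2≤ Pw with initLast ξs
P⇒shuffleForm _ _ _ _ () _ | []
P⇒shuffleForm _ _ _ _ (s≤s ()) _ | [] ∷ʳ′ _
P⇒shuffleForm _ _ _ _ _ {w} Pw   | (ξ₁ ∷ []) ∷ʳ′ ξ₂ = [] , ξ₁ , ξ₂ , [] , refl , w , [] , sym (++-identityʳ w) , Pw , refl
P⇒shuffleForm (suc n) _ (s≤s len) inds _ Pw | (ξ₁ ∷ ξ₂ ∷ mid) ∷ʳ′ ξᵣ =
  [ shuffleForm-∷  ∘ ·-mapˡ (P⇒shuffleForm n (ξ₂ ∷ mid ∷ʳ ξᵣ) len (All.tail inds) (s≤s 1≤length))
  , shuffleForm-∷ʳ ∘ ·-mapˡ (P⇒shuffleForm n init len-init inits (s≤s (s≤s z≤n)))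
  ]′ (peel-outer (⊕-∷ʳ init ξᵣ) (All.head inds) (All.head (All.++⁻ʳ init inds)) (bounded-⊕ (All.map bounded inits))
                 (2≤length-⊕ (All.tail inds) (s≤s 1≤length)) (2≤length-⊕ inits (s≤s (s≤s z≤n))) Pw)
  where
  init : List (List ℕ)
  init = ξ₁ ∷ ξ₂ ∷ mid
  1≤length : 1 ≤ length (mid ∷ʳ ξᵣ)
  1≤length = subst (1 ≤_) (sym (length-++ mid)) (m≤n+m 1 (length mid))
  inits : All ⊕-Indecomposable init
  inits = All.++⁻ˡ init inds
  len-init : length init ≤ n
  len-init = subst (_≤ n) (cong suc (trans (length-++ mid) (+-comm (length mid) 1))) len

-- Gluing blocks together

beyond : List Point → ℕ
beyond H = suc (max 0 (map px H) + max 0 (map py H))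

≺-translate-beyond : ∀ H {r} q → r ∈ H → r ≺ translate (beyond H) q
≺-translate-beyond H q r∈ =
  ≤-trans (s≤s (≤-trans (All.lookup (xs≤max 0 (map px H)) (∈-map⁺ px r∈)) (m≤m+n _ _))) (m≤n+m _ (px q)) ,
  ≤-trans (s≤s (≤-trans (All.lookup (xs≤max 0 (map py H)) (∈-map⁺ py r∈)) (m≤n+m _ _))) (m≤n+m _ (py q))

-- The pins of x are moved far up-right; the first pin of v, which lay in quadrant 3
-- of its origin o, then lies in quadrant 3 of the whole history.
P-append-lower : ∀ {σ τ x v} → Bounded τ → P σ x → Pq n1 τ v → P (τ ⊕₂ σ) (x ++ v)
P-append-lower {σ} {τ} {x} {v} bτ (p0 , ps , rx , fpσ) (o , qs , rv , fpτ , qs≺o) =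
  translate K p0 , map (translate K) ps ++ qs ,
  realizes-++⁺ x v (map (translate K) ps) qs (realizes-translate K x ps rx)
    (realizes-widen-≺ v qs (ʳ++-∷-≢-[] (map (translate K) ps)) rv qs≺o (All.map (λ q≺o → All.tabulate (q≺Q q≺o)) qs≺o)) ,
  formsPerm-⊕₂-swapped {ps = qs} {map (translate K) ps} bτ fpτ (formsPerm-translate K {ps} {σ} fpσ)
    (All.map (λ q≺o → All.map⁺ (All.tabulate (λ {r} _ → ≺-trans q≺o (≺-translate-beyond (o ∷ []) r (here refl))))) qs≺o)
  where
  K : ℕ
  K = beyond (o ∷ [])
  q≺Q : ∀ {q r} → q ≺ o → r ∈ map (translate K) ps ʳ++ (translate K p0 ∷ []) → q ≺ r
  q≺Q {r = r} q≺o r∈ with r₀ , _ , refl ← ∈-map⁻ (translate K) (subst (r ∈_) (sym (map-ʳ++ (translate K) ps)) r∈) =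
    ≺-trans q≺o (≺-translate-beyond (o ∷ []) r₀ (here refl))

P-append-upper : ∀ {σ τ x v} → Bounded σ → P σ x → Pq n3 τ v → P (σ ⊕₂ τ) (x ++ v)
P-append-upper {σ} {τ} {x} {v} bσ (p0 , ps , rx , fpσ) (o , qs , rv , fpτ , o≺qs) =
  p0 , ps ++ map (translate K) qs ,
  realizes-++⁺ x v ps (map (translate K) qs) rx
    (realizes-widen-≻ v (map (translate K) qs) (ʳ++-∷-≢-[] ps) (realizes-translate K v qs rv)
      (All.map⁺ (All.map (translate-≺ K) o≺qs)) (All.map⁺ (All.tabulate (λ {q} _ → All.tabulate (Q≺ q))))) ,
  formsPerm-⊕₂ {ps = ps} {map (translate K) qs} bσ fpσ (formsPerm-translate K {qs} {τ} fpτ)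
    (All.tabulate (λ p∈ → All.map⁺ (All.tabulate (λ {q} _ → ≺-translate-beyond (p0 ∷ ps) q (there p∈)))))
  where
  K : ℕ
  K = beyond (p0 ∷ ps)
  Q≺ : ∀ q {r} → r ∈ ps ʳ++ (p0 ∷ []) → r ≺ translate K q
  Q≺ q r∈ with reverseAcc⁻ (p0 ∷ []) ps r∈
  ... | inj₁ (here r≡p0) = ≺-translate-beyond (p0 ∷ ps) q (here r≡p0)
  ... | inj₂ r∈ps = ≺-translate-beyond (p0 ∷ ps) q (there r∈ps)

shuffle⇒P : ∀ los his core {x y} → All Bounded los → All Bounded his → All Bounded core →
  Sh (map (Pq n1) los) (map (Pq n3) his) y → P (⊕ core) x → P (⊕ (reverse los ++ core ++ his)) (x ++ y)
shuffle⇒P-lower : ∀ lo los his core {x a y} → All Bounded (lo ∷ los) → All Bounded his → All Bounded core →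
  Pq n1 lo a → Sh (map (Pq n1) los) (map (Pq n3) his) y → P (⊕ core) x →
  P (⊕ (reverse (lo ∷ los) ++ core ++ his)) (x ++ a ++ y)
shuffle⇒P-upper : ∀ los hi his core {x b y} → All Bounded los → All Bounded (hi ∷ his) → All Bounded core →
  Pq n3 hi b → Sh (map (Pq n1) los) (map (Pq n3) his) y → P (⊕ core) x →
  P (⊕ (reverse los ++ core ++ hi ∷ his)) (x ++ b ++ y)

shuffle⇒P []         []         core {x} _ _ _ refl Px =
  subst₂ (λ l w → P (⊕ l) w) (sym (++-identityʳ core)) (sym (++-identityʳ x)) Px
shuffle⇒P (lo ∷ los) []         core b-los b-his bc (_ , _ , refl , Pa , sh) Px =
  shuffle⇒P-lower lo los [] core b-los b-his bc Pa sh Px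
shuffle⇒P []         (hi ∷ his) core b-los b-his bc (_ , _ , refl , Pb , sh) Px =
  shuffle⇒P-upper [] hi his core b-los b-his bc Pb sh Px
shuffle⇒P (lo ∷ los) (hi ∷ his) core b-los b-his bc (inj₁ (_ , _ , refl , Pa , sh)) Px =
  shuffle⇒P-lower lo los (hi ∷ his) core b-los b-his bc Pa sh Px
shuffle⇒P (lo ∷ los) (hi ∷ his) core b-los b-his bc (inj₂ (_ , _ , refl , Pb , sh)) Px =
  shuffle⇒P-upper (lo ∷ los) hi his core b-los b-his bc Pb sh Px

shuffle⇒P-lower lo los his core {x} {a} {y} (b-lo ∷ b-los) b-his bc Pa sh Px =
  subst₂ (λ l w → P (⊕ l) w) blocks≡ (++-assoc x a y)
    (shuffle⇒P los his (lo ∷ core) b-los b-his (b-lo ∷ bc) sh (P-append-lower b-lo Px Pa))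
  where
  blocks≡ : reverse los ++ (lo ∷ core) ++ his ≡ reverse (lo ∷ los) ++ core ++ his
  blocks≡ = trans (sym (++-assoc (reverse los) (lo ∷ []) (core ++ his))) (cong (_++ core ++ his) (sym (unfold-reverse lo los)))

shuffle⇒P-upper los hi his core {x} {b} {y} b-los (b-hi ∷ b-his) bc Pb sh Px =
  subst₂ (λ l w → P (⊕ l) w) (cong (reverse los ++_) (++-assoc core (hi ∷ []) his)) (++-assoc x b y)
    (shuffle⇒P los his (core ++ hi ∷ []) b-los b-his (All.++⁺ bc (b-hi ∷ [])) sh
      (subst (λ π → P π (x ++ b)) (sym (⊕-∷ʳ core hi)) (P-append-upper (bounded-⊕ bc) Px Pb)))

shuffleForm⇒P : ∀ {ξs w} → All Bounded ξs → ShuffleForm ξs w → P (⊕ ξs) w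
shuffleForm⇒P bounds (as , a , b , bs , refl , x , y , refl , Px , sh) =
  subst (λ l → P (⊕ (l ++ a ∷ b ∷ bs)) (x ++ y)) (reverse-involutive as)
    (shuffle⇒P (reverse as) bs (a ∷ b ∷ []) (All.tabulate (λ v∈ → All.lookup bas (reverse⁻ v∈)))
      (All.tail (All.tail rest)) (All.head rest ∷ All.head (All.tail rest) ∷ []) sh Px)
  where
  bas : All Bounded as
  bas = All.++⁻ˡ as bounds
  rest : All Bounded (a ∷ b ∷ bs)
  rest = All.++⁻ʳ as bounds

theoremB12 : (ξs : List (List ℕ)) → 2 ≤ length ξs → All IncreasingOscillation ξs →
    (w : Word) →
    (P (⊕ ξs) w ⇔
      (Σ (List (List ℕ)) λ as → Σ (List ℕ) λ a → Σ (List ℕ) λ b → Σ (List (List ℕ)) λ bs →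
        ξs ≡ as ++ a ∷ b ∷ bs ×
        (P (⊕ (a ∷ b ∷ [])) · Sh (map (Pq n1) (reverse as)) (map (Pq n3) bs)) w))
theoremB12 ξs 2≤ oscs w =
  mk⇔ (P⇒shuffleForm (length ξs) ξs ≤-refl blocks 2≤) (shuffleForm⇒P (All.map bounded blocks))
  where
  blocks : All ⊕-Indecomposable ξs
  blocks = All.map incOsc⇒⊕-indecomposable oscs
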